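{- As $\Delta$ varies, the group $\text{Ш}_2(\mathcal C)$ of the Pell conic $\mathcal C: X^2-\Delta Y^2=4$ can have arbitrarily large $2$-rank.
   Context: Here $\Delta$ ranges over the values $\Delta=d$ for squarefree $d\equiv1\pmod4$, $d\ne1$, and $\Delta=4d$ for squarefree $d\equiv 2,3\pmod 4$. For a positive squarefree divisor $a$ of $\Delta$ let $\mathcal T_a$ be the curve $ar^2-(\Delta/a)s^2=4$. $\mathrm{Sel}_2(\mathcal C)$ is the subgroup of $\mathbb Q^\times/\mathbb Q^{\times2}$ of the classes $a\mathbb Q^{\times2}$, $a$ a positive squarefree divisor of $\Delta$, with $\mathcal T_a$ having a rational point; $W_2(\mathcal C)$ is the subgroup of classes with $\mathcal T_a$ having an integral point; $\text{Ш}_2(\mathcal C)=\mathrm{Sel}_2(\mathcal C)/W_2(\mathcal C)$, an elementary abelian $2$-group. -}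

module Defs where

open import Data.Nat as ℕ using (ℕ; zero; suc)
open import Data.Nat.Divisibility using (_∣_)
open import Data.Integer as ℤ using (ℤ; +_)
open import Data.Integer.DivMod using (_%ℕ_)
open import Data.Rational as ℚ using (ℚ)
open import Data.Fin using (Fin; zero; suc)
open import Data.Bool using (Bool; true; false)
open import Data.Product using (Σ; ∃; _×_; _,_)
open import Data.Sum using (_⊎_)
open import Relation.Binary.PropositionalEquality using (_≡_)
open import Relation.Nullary using (¬_)

-- squarefree natural number (0 is not squarefree since 2*2 ∣ 0)
SquarefreeN : ℕ → Set
SquarefreeN n = ∀ p → (p ℕ.* p) ∣ n → p ≡ 1

IsDisc : ℤ → Set
IsDisc Δ = Σ ℤ λ d → SquarefreeN (ℤ.∣ d ∣) ×
  ((d %ℕ 4 ≡ 1 × ¬ (d ≡ + 1) × Δ ≡ d)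
   ⊎ ((d %ℕ 4 ≡ 2 ⊎ d %ℕ 4 ≡ 3) × Δ ≡ + 4 ℤ.* d))

⟦_⟧ : ℤ → ℚ
⟦ z ⟧ = z ℚ./ 1

SqfDiv : ℤ → ℕ → Set
SqfDiv Δ a = SquarefreeN a × Σ ℤ λ b → (+ a) ℤ.* b ≡ Δ

TRational : ℤ → ℕ → Set
TRational Δ a = Σ ℤ λ b → (+ a) ℤ.* b ≡ Δ ×
  Σ ℚ λ r → Σ ℚ λ s → (⟦ + a ⟧ ℚ.* r ℚ.* r) ℚ.- (⟦ b ⟧ ℚ.* s ℚ.* s) ≡ ⟦ + 4 ⟧

TIntegral : ℤ → ℕ → Set
TIntegral Δ a = Σ ℤ λ b → (+ a) ℤ.* b ≡ Δ ×
  Σ ℤ λ r → Σ ℤ λ s → ((+ a) ℤ.* r ℤ.* r) ℤ.- (b ℤ.* s ℤ.* s) ≡ + 4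

-- representatives of classes in Sel₂(C) and W₂(C)
InSel : ℤ → ℕ → Set
InSel Δ a = SquarefreeN a × TRational Δ a

InW : ℤ → ℕ → Set
InW Δ a = SquarefreeN a × TIntegral Δ a

IsSquareN : ℕ → Set
IsSquareN m = Σ ℕ λ k → k ℕ.* k ≡ m

prodSub : ∀ n → (Fin n → ℕ) → (Fin n → Bool) → ℕ
prodSub zero a S = 1
prodSub (suc n) a S with S zero
... | true  = a zero ℕ.* prodSub n (λ i → a (suc i)) (λ i → S (suc i))
... | false = prodSub n (λ i → a (suc i)) (λ i → S (suc i))

-- the classes a_i Q^{×2} (i < n) are F₂-linearly independent in Sel₂/W₂:
-- no nonempty subproduct lies in W₂ (i.e. equals c·Q^{×2} for some c ∈ W₂)
IndepModW : ℤ → ∀ n → (Fin n → ℕ) → Set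
IndepModW Δ n a = ∀ (S : Fin n → Bool) → (Σ (Fin n) λ i → S i ≡ true) →
  ¬ (Σ ℕ λ c → InW Δ c × IsSquareN (c ℕ.* prodSub n a S))

-- 2-rank of Ш₂(C) = Sel₂/W₂ is at least n
ShaRankAtLeast : ℤ → ℕ → Set
ShaRankAtLeast Δ n = Σ (Fin n → ℕ) λ a → (∀ i → InSel Δ (a i)) × IndepModW Δ n a

{-# OPTIONS --safe #-}
module Submission where

open import Defs
open import Data.Nat using (ℕ)
open import Data.Integer using (ℤ)
open import Data.Product using (Σ; _×_)

module QuadraticExtensions where
  open import Level using (0ℓ)
  open import Algebra.Bundles using (CommutativeRing; AbelianGroup)
  open import Algebra.Core using (Op₂)
  import Algebra.Consequences.Setoid as Consequences
  import Algebra.Construct.DirectProduct as DirectProduct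
  open import Algebra.Morphism.Structures using (module RingMorphisms)
  import Algebra.Properties.CommutativeSemigroup as CommutativeSemigroupProperties
  import Algebra.Properties.Ring as RingProperties
  import Algebra.Properties.Semiring.Mult as SemiringMult
  import Algebra.Solver.Ring as RingSolver
  open import Algebra.Solver.Ring.AlmostCommutativeRing using (_-Raw-AlmostCommutative⟶_; fromCommutativeRing)
  open import Data.Integer.Base as ℤ using (+_; -[1+_]; _⊖_)
  import Data.Integer.Properties as ℤₚ
  open import Data.List.Base using (List; []; _∷_)
  open import Data.List.Membership.Propositional using (_∈_)
  open import Data.List.Relation.Unary.All using (All; []; _∷_)
  open import Data.List.Relation.Unary.Any using (here; there)
  open import Data.Maybe.Base using (Maybe; just; nothing)
  open import Data.Nat.Base as ℕ using (zero; suc)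
  import Data.Nat.Properties as ℕₚ
  open import Data.Product.Base using (Σ-syntax; _,_; proj₁; proj₂)
  import Relation.Binary.PropositionalEquality.Core as ≡
  open import Relation.Nullary.Decidable.Core using (yes; no)

  module IntegerMultiples (R : CommutativeRing 0ℓ 0ℓ) where
    open CommutativeRing R
    open RingProperties ring using (-‿involutive; -0#≈0#; -‿distribˡ-*; -‿distribʳ-*; -‿+-comm)
    open CommutativeSemigroupProperties +-commutativeSemigroup using (interchange)
    open SemiringMult semiring using (×-homo-+; ×1-homo-*) renaming (_×_ to _·_)
    open import Relation.Binary.Reasoning.Setoid setoid

    ι : ℤ → Carrier
    ι (+ n)    = n · 1#
    ι -[1+ n ] = - (suc n · 1#)

    ι-‿homo : ∀ i → ι (ℤ.- i) ≈ - ι i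
    ι-‿homo (+ zero)   = sym -0#≈0#
    ι-‿homo (+ suc n)  = refl
    ι-‿homo -[1+ n ]   = sym (-‿involutive _)

    private
      ι-⊖ : ∀ m n → ι (m ⊖ n) ≈ m · 1# - n · 1#
      ι-⊖ m zero = begin
        ι (m ⊖ 0)        ≡⟨ ≡.cong ι (ℤₚ.⊖-≥ {m} ℕ.z≤n) ⟩
        m · 1#           ≈⟨ +-identityʳ _ ⟨
        m · 1# + 0#      ≈⟨ +-congˡ -0#≈0# ⟨
        m · 1# - 0 · 1#  ∎
      ι-⊖ zero (suc n) = sym (+-identityˡ _)
      ι-⊖ (suc m) (suc n) = begin
        ι (suc m ⊖ suc n)                  ≡⟨ ≡.cong ι (ℤₚ.[1+m]⊖[1+n]≡m⊖n m n) ⟩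
        ι (m ⊖ n)                          ≈⟨ ι-⊖ m n ⟩
        m · 1# - n · 1#                    ≈⟨ +-identityˡ _ ⟨
        0# + (m · 1# - n · 1#)             ≈⟨ +-congʳ (-‿inverseʳ 1#) ⟨
        (1# - 1#) + (m · 1# - n · 1#)      ≈⟨ interchange _ _ _ _ ⟩
        suc m · 1# + (- 1# - n · 1#)       ≈⟨ +-congˡ (-‿+-comm 1# (n · 1#)) ⟩
        suc m · 1# - suc n · 1#            ∎

    ι-+-homo : ∀ i j → ι (i ℤ.+ j) ≈ ι i + ι j
    ι-+-homo -[1+ m ] -[1+ n ] = begin
      - (suc (suc (m ℕ.+ n)) · 1#)  ≡⟨ ≡.cong (λ k → - (suc k · 1#)) (ℕₚ.+-suc m n) ⟨
      - ((suc m ℕ.+ suc n) · 1#)    ≈⟨ -‿cong (×-homo-+ 1# (suc m) (suc n)) ⟩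
      - (suc m · 1# + suc n · 1#)   ≈⟨ -‿+-comm _ _ ⟨
      ι -[1+ m ] + ι -[1+ n ]       ∎
    ι-+-homo -[1+ m ] (+ n) = trans (ι-⊖ n (suc m)) (+-comm _ _)
    ι-+-homo (+ m) -[1+ n ] = ι-⊖ m (suc n)
    ι-+-homo (+ m) (+ n)    = ×-homo-+ 1# m n

    private
      ι-pos-* : ∀ m n → ι (+ m ℤ.* + n) ≈ ι (+ m) * ι (+ n)
      ι-pos-* m n = begin
        ι (+ m ℤ.* + n)  ≡⟨ ≡.cong ι (ℤₚ.pos-* m n) ⟨
        (m ℕ.* n) · 1#   ≈⟨ ×1-homo-* m n ⟩
        m · 1# * n · 1#  ∎

    ι-*-homo : ∀ i j → ι (i ℤ.* j) ≈ ι i * ι j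
    ι-*-homo (+ m) (+ n) = ι-pos-* m n
    ι-*-homo (+ m) -[1+ n ] = begin
      ι (+ m ℤ.* -[1+ n ])           ≡⟨ ≡.cong ι (ℤₚ.neg-distribʳ-* (+ m) (+ suc n)) ⟨
      ι (ℤ.- (+ m ℤ.* + suc n))      ≈⟨ ι-‿homo (+ m ℤ.* + suc n) ⟩
      - ι (+ m ℤ.* + suc n)          ≈⟨ -‿cong (ι-pos-* m (suc n)) ⟩
      - (ι (+ m) * ι (+ suc n))      ≈⟨ -‿distribʳ-* _ _ ⟩
      ι (+ m) * ι -[1+ n ]           ∎
    ι-*-homo -[1+ m ] (+ n) = begin
      ι (-[1+ m ] ℤ.* + n)           ≡⟨ ≡.cong ι (ℤₚ.neg-distribˡ-* (+ suc m) (+ n)) ⟨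
      ι (ℤ.- (+ suc m ℤ.* + n))      ≈⟨ ι-‿homo (+ suc m ℤ.* + n) ⟩
      - ι (+ suc m ℤ.* + n)          ≈⟨ -‿cong (ι-pos-* (suc m) n) ⟩
      - (ι (+ suc m) * ι (+ n))      ≈⟨ -‿distribˡ-* _ _ ⟩
      ι -[1+ m ] * ι (+ n)           ∎
    ι-*-homo -[1+ m ] -[1+ n ] = begin
      ι (+ suc m ℤ.* + suc n)        ≈⟨ ι-pos-* (suc m) (suc n) ⟩
      ι (+ suc m) * ι (+ suc n)      ≈⟨ -‿involutive _ ⟨
      - - (ι (+ suc m) * ι (+ suc n)) ≈⟨ -‿cong (-‿distribˡ-* _ _) ⟩
      - (ι -[1+ m ] * ι (+ suc n))   ≈⟨ -‿distribʳ-* _ _ ⟩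
      ι -[1+ m ] * ι -[1+ n ]        ∎

    ι-homomorphism : ℤ.+-*-rawRing -Raw-AlmostCommutative⟶ fromCommutativeRing R
    ι-homomorphism = record
      { ⟦_⟧    = ι
      ; +-homo = ι-+-homo
      ; *-homo = ι-*-homo
      ; -‿homo = ι-‿homo
      ; 0-homo = refl
      ; 1-homo = +-identityʳ 1#
      }

    private
      ι-≈? : ∀ i j → Maybe (ι i ≈ ι j)
      ι-≈? i j with i ℤₚ.≟ j
      ... | yes ≡.refl = just refl
      ... | no _       = nothing

    open RingSolver ℤ.+-*-rawRing (fromCommutativeRing R) ι-homomorphism ι-≈? public
      using (solve; _:=_; _:+_; _:*_; :-_; _:-_; con)

  module Adjoin√ (R : CommutativeRing 0ℓ 0ℓ) (b : ℤ) where
    open CommutativeRing R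
    open IntegerMultiples R

    private
      additive : AbelianGroup 0ℓ 0ℓ
      additive = DirectProduct.abelianGroup +-abelianGroup +-abelianGroup
      module A = AbelianGroup additive

    infixl 7 _⊛_
    _⊛_ : Op₂ (Carrier × Carrier)
    (u , v) ⊛ (u′ , v′) = (u * u′ + ι b * (v * v′) , u * v′ + v * u′)

    N : Carrier × Carrier → Carrier
    N (u , v) = u * u - ι b * (v * v)

    private
      ⊛-cong : ∀ {x y u v} → x A.≈ y → u A.≈ v → x ⊛ u A.≈ y ⊛ v
      ⊛-cong (p , q) (p′ , q′) = +-cong (*-cong p p′) (*-congˡ (*-cong q q′)) , +-cong (*-cong p q′) (*-cong q p′)

      ⊛-assoc : ∀ x y z → (x ⊛ y) ⊛ z A.≈ x ⊛ (y ⊛ z)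
      ⊛-assoc (u , v) (u′ , v′) (u″ , v″) =
        solve 7 (λ β u v u′ v′ u″ v″ →
          (u :* u′ :+ β :* (v :* v′)) :* u″ :+ β :* ((u :* v′ :+ v :* u′) :* v″)
          := u :* (u′ :* u″ :+ β :* (v′ :* v″)) :+ β :* (v :* (u′ :* v″ :+ v′ :* u″)))
          refl (ι b) u v u′ v′ u″ v″ ,
        solve 7 (λ β u v u′ v′ u″ v″ →
          (u :* u′ :+ β :* (v :* v′)) :* v″ :+ (u :* v′ :+ v :* u′) :* u″
          := u :* (u′ :* v″ :+ v′ :* u″) :+ v :* (u′ :* u″ :+ β :* (v′ :* v″)))
          refl (ι b) u v u′ v′ u″ v″

      ⊛-comm : ∀ x y → x ⊛ y A.≈ y ⊛ x
      ⊛-comm (u , v) (u′ , v′) =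
        +-cong (*-comm u u′) (*-congˡ (*-comm v v′)) ,
        trans (+-comm _ _) (+-cong (*-comm v u′) (*-comm u v′))

      ⊛-identityˡ : ∀ x → (1# , 0#) ⊛ x A.≈ x
      ⊛-identityˡ (u , v) =
        trans (+-cong (*-identityˡ u) (trans (*-congˡ (zeroˡ v)) (zeroʳ _))) (+-identityʳ u) ,
        trans (+-cong (*-identityˡ v) (zeroˡ u)) (+-identityʳ v)

      ⊛-distribˡ : ∀ x y z → x ⊛ (y A.∙ z) A.≈ (x ⊛ y) A.∙ (x ⊛ z)
      ⊛-distribˡ (u , v) (u′ , v′) (u″ , v″) =
        solve 7 (λ β u v u′ v′ u″ v″ →
          u :* (u′ :+ u″) :+ β :* (v :* (v′ :+ v″))
          := (u :* u′ :+ β :* (v :* v′)) :+ (u :* u″ :+ β :* (v :* v″)))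
          refl (ι b) u v u′ v′ u″ v″ ,
        solve 6 (λ u v u′ v′ u″ v″ →
          u :* (v′ :+ v″) :+ v :* (u′ :+ u″) := (u :* v′ :+ v :* u′) :+ (u :* v″ :+ v :* u″))
          refl u v u′ v′ u″ v″

      open Consequences A.setoid using (comm∧idˡ⇒id; comm∧distrˡ⇒distr)

    extension : CommutativeRing 0ℓ 0ℓ
    extension = record
      { Carrier = Carrier × Carrier
      ; _≈_ = A._≈_
      ; _+_ = A._∙_
      ; _*_ = _⊛_
      ; -_ = A._⁻¹
      ; 0# = A.ε
      ; 1# = (1# , 0#)
      ; isCommutativeRing = record
        { isRing = record
          { +-isAbelianGroup = A.isAbelianGroup
          ; *-cong = ⊛-cong
          ; *-assoc = ⊛-assoc
          ; *-identity = comm∧idˡ⇒id ⊛-comm ⊛-identityˡ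
          ; distrib = comm∧distrˡ⇒distr A.∙-cong ⊛-comm ⊛-distribˡ
          }
        ; *-comm = ⊛-comm
        }
      }

  _[√_] : CommutativeRing 0ℓ 0ℓ → ℤ → CommutativeRing 0ℓ 0ℓ
  R [√ b ] = Adjoin√.extension R b

  record IsHomomorphism (R S : CommutativeRing 0ℓ 0ℓ)
                        (f : CommutativeRing.Carrier R → CommutativeRing.Carrier S) : Set where
    field
      isRingHomomorphism : RingMorphisms.IsRingHomomorphism (CommutativeRing.rawRing R) (CommutativeRing.rawRing S) f
    open RingMorphisms.IsRingHomomorphism isRingHomomorphism public

  module _ {R S : CommutativeRing 0ℓ 0ℓ} {f : CommutativeRing.Carrier R → CommutativeRing.Carrier S} where
    private
      module R = CommutativeRing R
      module S = CommutativeRing S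

    isHomomorphism : (∀ {x y} → x R.≈ y → f x S.≈ f y) →
                     (∀ x y → f (x R.+ y) S.≈ f x S.+ f y) →
                     (∀ x y → f (x R.* y) S.≈ f x S.* f y) →
                     (∀ x → f (R.- x) S.≈ S.- f x) →
                     f R.0# S.≈ S.0# → f R.1# S.≈ S.1# →
                     IsHomomorphism R S f
    isHomomorphism cong +-homo *-homo -‿homo 0#-homo 1#-homo = record { isRingHomomorphism = record
      { isSemiringHomomorphism = record
        { isNearSemiringHomomorphism = record
          { +-isMonoidHomomorphism = record
            { isMagmaHomomorphism = record
              { isRelHomomorphism = record { cong = cong }
              ; homo = +-homo
              }
            ; ε-homo = 0#-homo
            }
          ; *-homo = *-homo
          }
        ; 1#-homo = 1#-homo
        }
      ; -‿homo = -‿homo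
      } }

  module _ {R S : CommutativeRing 0ℓ 0ℓ} {f : CommutativeRing.Carrier R → CommutativeRing.Carrier S}
           (h : IsHomomorphism R S f) where
    private
      module R = CommutativeRing R
      module S = CommutativeRing S
    open IsHomomorphism h
    open S using (_≈_; _+_; _*_; -_; _-_; +-cong; -‿cong; *-cong; *-congˡ; trans; refl)
    open IntegerMultiples using (ι)
    open SemiringMult R.semiring using () renaming (_×_ to _·ᴿ_)
    open SemiringMult S.semiring using () renaming (_×_ to _·ˢ_)

    ι-homo : ∀ z → f (ι R z) ≈ ι S z
    ι-homo (+ n)    = multiple-homo n
      where
      multiple-homo : ∀ n → f (n ·ᴿ R.1#) ≈ n ·ˢ S.1#
      multiple-homo zero    = 0#-homo
      multiple-homo (suc n) = trans (+-homo _ _) (+-cong 1#-homo (multiple-homo n))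
    ι-homo -[1+ n ] = trans (-‿homo _) (-‿cong (ι-homo (+ suc n)))

    N-homo : ∀ b w → f (Adjoin√.N R b w) ≈ Adjoin√.N S b (f (proj₁ w) , f (proj₂ w))
    N-homo b (u , v) =
      trans (+-homo _ _) (+-cong (*-homo u u) (trans (-‿homo _) (-‿cong
        (trans (*-homo _ _) (*-cong (ι-homo b) (*-homo v v))))))

    lift : ∀ b → IsHomomorphism (R [√ b ]) (S [√ b ]) (λ w → f (proj₁ w) , f (proj₂ w))
    lift b = isHomomorphism {R [√ b ]} {S [√ b ]}
      (λ (p , q) → ⟦⟧-cong p , ⟦⟧-cong q)
      (λ _ _ → +-homo _ _ , +-homo _ _)
      (λ (u , v) (u′ , v′) →
        trans (+-homo _ _) (+-cong (*-homo u u′) (trans (*-homo _ _) (*-cong (ι-homo b) (*-homo v v′)))) ,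
        trans (+-homo _ _) (+-cong (*-homo u v′) (*-homo v u′)))
      (λ _ → -‿homo _ , -‿homo _)
      (0#-homo , 0#-homo)
      (1#-homo , 0#-homo)

  module _ (R : CommutativeRing 0ℓ 0ℓ) (b : ℤ) where
    open CommutativeRing R
    open Adjoin√ R b using (N)

    N-cong : ∀ {w w′} → CommutativeRing._≈_ (R [√ b ]) w w′ → N w ≈ N w′
    N-cong (p , q) = +-cong (*-cong p p) (-‿cong (*-congˡ (*-cong q q)))

  -- norm R [b₁, …, bₖ] x is the norm from R[√b₁]⋯[√bₖ] down to R of x + √b₁ + ⋯ + √bₖ.
  norm : (R : CommutativeRing 0ℓ 0ℓ) → List ℤ → CommutativeRing.Carrier R → CommutativeRing.Carrier R
  norm R []      x = x
  norm R (b ∷ F) x = Adjoin√.N R b (norm (R [√ b ]) F (x , CommutativeRing.1# R))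

  norm-cong : ∀ (R : CommutativeRing 0ℓ 0ℓ) F {x y} → CommutativeRing._≈_ R x y →
              CommutativeRing._≈_ R (norm R F x) (norm R F y)
  norm-cong R []      p = p
  norm-cong R (b ∷ F) p = N-cong R b (norm-cong (R [√ b ]) F (p , CommutativeRing.refl R))

  norm-homo : ∀ {R S : CommutativeRing 0ℓ 0ℓ} {f} → IsHomomorphism R S f → ∀ F x →
              CommutativeRing._≈_ S (f (norm R F x)) (norm S F (f x))
  norm-homo {S = S} h []      x = CommutativeRing.refl S
  norm-homo {R} {S} h (b ∷ F) x = S.trans (N-homo h b _) (N-cong S b (S[√b].trans
    (norm-homo (lift h b) F (x , R.1#))
    (norm-cong (S [√ b ]) F (S.refl , 1#-homo))))
    where
    module R = CommutativeRing R
    module S = CommutativeRing S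
    module S[√b] = CommutativeRing (S [√ b ])
    open IsHomomorphism h using (1#-homo)

  module _ (R : CommutativeRing 0ℓ 0ℓ) (b : ℤ) where
    open CommutativeRing R
    open RingProperties ring using (-0#≈0#)
    private
      module E = CommutativeRing (R [√ b ])

    inclusion : IsHomomorphism R (R [√ b ]) (_, 0#)
    inclusion = isHomomorphism {R} {R [√ b ]}
      (λ p → p , refl)
      (λ _ _ → refl , sym (+-identityʳ 0#))
      (λ u u′ → sym (trans (+-congˡ (trans (*-congˡ (zeroˡ 0#)) (zeroʳ _))) (+-identityʳ _)) ,
                sym (trans (+-cong (zeroʳ u) (zeroˡ u′)) (+-identityʳ 0#)))
      (λ _ → refl , sym -0#≈0#)
      E.refl
      E.refl

    ι-[√] : ∀ z → IntegerMultiples.ι (R [√ b ]) z E.≈ (IntegerMultiples.ι R z , 0#)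
    ι-[√] z = E.sym (ι-homo inclusion z)

  module _ (R : CommutativeRing 0ℓ 0ℓ) (b₀ b : ℤ) where
    open CommutativeRing R
    open IntegerMultiples R
    private
      module E = CommutativeRing (R [√ b₀ ])

    -- The norm to R of an element of R[√b₀] which is a norm from R[√b₀][√b] is itself a norm from R[√b].
    N-N : ∀ U V → Adjoin√.N R b₀ (U E.* U E.- (ι b , 0#) E.* (V E.* V)) ≈
                  Adjoin√.N R b (proj₁ U * proj₁ U + ι b * (proj₁ V * proj₁ V) - ι b₀ * (proj₂ U * proj₂ U) - ι b₀ * (ι b * (proj₂ V * proj₂ V)) ,
                                 (proj₁ U * proj₁ V - ι b₀ * (proj₂ U * proj₂ V)) + (proj₁ U * proj₁ V - ι b₀ * (proj₂ U * proj₂ V)))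
    N-N (u₁ , u₂) (v₁ , v₂) = solve 6 (λ β₀ β u₁ u₂ v₁ v₂ →
      let X = (u₁ :* u₁ :+ β₀ :* (u₂ :* u₂)) :- (β :* (v₁ :* v₁ :+ β₀ :* (v₂ :* v₂)) :+ β₀ :* (con (+ 0) :* (v₁ :* v₂ :+ v₂ :* v₁)))
          Y = (u₁ :* u₂ :+ u₂ :* u₁) :- (β :* (v₁ :* v₂ :+ v₂ :* v₁) :+ con (+ 0) :* (v₁ :* v₁ :+ β₀ :* (v₂ :* v₂)))
          P = u₁ :* u₁ :+ β :* (v₁ :* v₁) :- β₀ :* (u₂ :* u₂) :- β₀ :* (β :* (v₂ :* v₂))
          Q = (u₁ :* v₁ :- β₀ :* (u₂ :* v₂)) :+ (u₁ :* v₁ :- β₀ :* (u₂ :* v₂))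
      in X :* X :- β₀ :* (Y :* Y) := P :* P :- β :* (Q :* Q))
      refl (ι b₀) (ι b) u₁ u₂ v₁ v₂

  norm-isNorm : ∀ (R : CommutativeRing 0ℓ 0ℓ) {b} F x → b ∈ F →
                Σ[ w ∈ CommutativeRing.Carrier (R [√ b ]) ] CommutativeRing._≈_ R (norm R F x) (Adjoin√.N R b w)
  norm-isNorm R (b ∷ F) x (here ≡.refl) = _ , CommutativeRing.refl R
  norm-isNorm R {b} (b₀ ∷ F) x (there b∈F) with norm-isNorm (R [√ b₀ ]) F (x , CommutativeRing.1# R) b∈F
  ... | (U , V) , eq = _ , R.trans (N-cong R b₀ (E.trans eq (E.+-congˡ (E.-‿cong (E.*-congʳ (ι-[√] R b₀ b))))))
                                   (N-N R b₀ b U V)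
    where
    module R = CommutativeRing R
    module E = CommutativeRing (R [√ b₀ ])

  module _ (R : CommutativeRing 0ℓ 0ℓ) {b : ℤ} where
    open CommutativeRing R
    open IntegerMultiples R
    open RingProperties ring using (-0#≈0#)
    private
      module E = CommutativeRing (R [√ b ])

    projection : ι b ≈ 0# → IsHomomorphism (R [√ b ]) R proj₁
    projection b≈0 = isHomomorphism {R [√ b ]} {R}
      proj₁
      (λ _ _ → refl)
      (λ _ _ → trans (+-congˡ (trans (*-congʳ b≈0) (zeroˡ _))) (+-identityʳ _))
      (λ _ → refl)
      refl
      refl

    evaluation : ∀ {t} → t * t ≈ ι b → IsHomomorphism (R [√ b ]) R (λ (u , v) → u + t * v)
    evaluation {t} t²≈b = isHomomorphism {R [√ b ]} {R}
      (λ (p , q) → +-cong p (*-congˡ q))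
      (λ (u , v) (u′ , v′) → solve 5 (λ t u v u′ v′ →
        (u :+ u′) :+ t :* (v :+ v′) := (u :+ t :* v) :+ (u′ :+ t :* v′)) refl t u v u′ v′)
      (λ (u , v) (u′ , v′) → trans
        (+-congʳ (+-congˡ (*-congʳ (sym t²≈b))))
        (solve 5 (λ t u v u′ v′ →
          (u :* u′ :+ (t :* t) :* (v :* v′)) :+ t :* (u :* v′ :+ v :* u′) := (u :+ t :* v) :* (u′ :+ t :* v′))
          refl t u v u′ v′))
      (λ (u , v) → solve 3 (λ t u v → (:- u) :+ t :* (:- v) := :- (u :+ t :* v)) refl t u v)
      (trans (+-congˡ (zeroʳ t)) (+-identityʳ 0#))
      (trans (+-congˡ (zeroʳ t)) (+-identityʳ 1#))

  module _ (R : CommutativeRing 0ℓ 0ℓ) where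
    open CommutativeRing R
    open IntegerMultiples R
    open RingProperties ring using (-0#≈0#)
    open import Relation.Binary.Reasoning.Setoid setoid

    norm≈1 : ∀ F {x} → All (λ b → ι b ≈ 0#) F → x ≈ 1# → norm R F x ≈ 1#
    norm≈1 []      []          x≈1 = x≈1
    norm≈1 (b ∷ F) {x} (b≈0 ∷ F≈0) x≈1 = begin
      w₁ * w₁ - ι b * (w₂ * w₂)  ≈⟨ +-cong (*-cong w₁≈1 w₁≈1) (-‿cong (trans (*-congʳ b≈0) (zeroˡ _))) ⟩
      1# * 1# - 0#               ≈⟨ +-cong (*-identityˡ 1#) -0#≈0# ⟩
      1# + 0#                    ≈⟨ +-identityʳ 1# ⟩
      1#                         ∎
      where
      w₁ = proj₁ (norm (R [√ b ]) F (x , 1#))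
      w₂ = proj₂ (norm (R [√ b ]) F (x , 1#))
      w₁≈1 : w₁ ≈ 1#
      w₁≈1 = trans (norm-homo (projection R {b} b≈0) F (x , 1#)) (norm≈1 F F≈0 x≈1)

    norm-split : ∀ {b} F x {s} → s * s ≈ ι b → norm R (b ∷ F) x ≈ norm R F (x + s) * norm R F (x - s)
    norm-split {b} F x {s} s²≈b = begin
      w₁ * w₁ - ι b * (w₂ * w₂)           ≈⟨ +-congˡ (-‿cong (*-congʳ (sym s²≈b))) ⟩
      w₁ * w₁ - (s * s) * (w₂ * w₂)       ≈⟨ solve 3 (λ s w₁ w₂ →
                                               w₁ :* w₁ :- (s :* s) :* (w₂ :* w₂) := (w₁ :+ s :* w₂) :* (w₁ :+ (:- s) :* w₂))
                                               refl s w₁ w₂ ⟩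
      (w₁ + s * w₂) * (w₁ + (- s) * w₂)   ≈⟨ *-cong (at s s²≈b) (at (- s) (trans (-s*-s≈s*s s) s²≈b)) ⟩
      norm R F (x + s) * norm R F (x - s) ∎
      where
      w₁ = proj₁ (norm (R [√ b ]) F (x , 1#))
      w₂ = proj₂ (norm (R [√ b ]) F (x , 1#))
      -s*-s≈s*s : ∀ s → (- s) * (- s) ≈ s * s
      -s*-s≈s*s s = solve 1 (λ s → (:- s) :* (:- s) := s :* s) refl s
      at : ∀ t → t * t ≈ ι b → w₁ + t * w₂ ≈ norm R F (x + t)
      at t t²≈b = trans (norm-homo (evaluation R {b} t²≈b) F (x , 1#)) (norm-cong R F (+-congˡ (*-identityʳ t)))

module Congruences where
  open QuadraticExtensions
  open import Level using (0ℓ)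
  open import Algebra.Bundles using (CommutativeRing)
  open import Data.Integer.Base as ℤ using (+_; -[1+_]; 0ℤ; 1ℤ; _+_; _*_; -_; _-_)
  import Data.Integer.Properties as ℤₚ
  open import Data.Integer.Divisibility.Signed
    using (_∣_; divides; ∣m∣n⇒∣m+n; ∣m⇒∣-m; ∣m⇒∣m*n; ∣n⇒∣m*n; ∣ᵤ⇒∣; ∣⇒∣ᵤ; *-cancelˡ-∣)
  open import Data.Integer.Tactic.RingSolver using (solve)
  open import Data.List.Base using ([]; _∷_)
  open import Data.Nat.Base as ℕ using (zero; suc)
  import Data.Nat.Divisibility as ℕ∣
  import Data.Nat.Properties as ℕₚ
  open import Data.Nat.Primality using (Prime; euclidsLemma; prime⇒nonZero)
  open import Data.Product.Base using (_,_)
  open import Data.Sum.Base as Sum using (_⊎_)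
  open import Function.Base using (id)
  open import Relation.Binary.PropositionalEquality as ≡ using (_≡_; refl; cong)
  open import Relation.Nullary.Negation.Core using (¬_)

  infix 4 _≡_[mod_]
  record _≡_[mod_] (x y n : ℤ) : Set where
    constructor congruent
    field divides-difference : n ∣ x - y

  open _≡_[mod_] public

  module _ (n : ℤ) where
    private
      divisible : ∀ {d x y} → n ∣ d → x - y ≡ d → x ≡ y [mod n ]
      divisible (divides k eq) e = congruent (divides k (≡.trans e eq))

    ≡⇒≡[mod] : ∀ {x y} → x ≡ y → x ≡ y [mod n ]
    ≡⇒≡[mod] {x} refl = congruent (divides 0ℤ (≡.trans (ℤₚ.+-inverseʳ x) (≡.sym (ℤₚ.*-zeroˡ n))))

    ≡[mod]-sym : ∀ {x y} → x ≡ y [mod n ] → y ≡ x [mod n ]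
    ≡[mod]-sym {x} {y} x≡y = divisible (∣m⇒∣-m (divides-difference x≡y)) (solve (x ∷ y ∷ []))

    ≡[mod]-trans : ∀ {x y z} → x ≡ y [mod n ] → y ≡ z [mod n ] → x ≡ z [mod n ]
    ≡[mod]-trans {x} {y} {z} x≡y y≡z = divisible (∣m∣n⇒∣m+n (divides-difference x≡y) (divides-difference y≡z)) (solve (x ∷ y ∷ z ∷ []))

    ≡[mod]-+-cong : ∀ {x y u v} → x ≡ y [mod n ] → u ≡ v [mod n ] → x + u ≡ y + v [mod n ]
    ≡[mod]-+-cong {x} {y} {u} {v} x≡y u≡v = divisible (∣m∣n⇒∣m+n (divides-difference x≡y) (divides-difference u≡v)) (solve (x ∷ y ∷ u ∷ v ∷ []))

    ≡[mod]-*-cong : ∀ {x y u v} → x ≡ y [mod n ] → u ≡ v [mod n ] → x * u ≡ y * v [mod n ]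
    ≡[mod]-*-cong {x} {y} {u} {v} x≡y u≡v =
      divisible (∣m∣n⇒∣m+n (∣m⇒∣m*n u (divides-difference x≡y)) (∣n⇒∣m*n y (divides-difference u≡v))) (solve (x ∷ y ∷ u ∷ v ∷ []))

    ≡[mod]-‿cong : ∀ {x y} → x ≡ y [mod n ] → - x ≡ - y [mod n ]
    ≡[mod]-‿cong {x} {y} x≡y = divisible (∣m⇒∣-m (divides-difference x≡y)) (solve (x ∷ y ∷ []))

    ℤ/ : CommutativeRing 0ℓ 0ℓ
    ℤ/ = record
      { Carrier = ℤ
      ; _≈_ = _≡_[mod n ]
      ; _+_ = _+_
      ; _*_ = _*_
      ; -_ = -_
      ; 0# = 0ℤ
      ; 1# = 1ℤ
      ; isCommutativeRing = record
        { isRing = record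
          { +-isAbelianGroup = record
            { isGroup = record
              { isMonoid = record
                { isSemigroup = record
                  { isMagma = record
                    { isEquivalence = record
                      { refl = ≡⇒≡[mod] refl ; sym = ≡[mod]-sym ; trans = ≡[mod]-trans }
                    ; ∙-cong = ≡[mod]-+-cong
                    }
                  ; assoc = λ x y z → ≡⇒≡[mod] (ℤₚ.+-assoc x y z)
                  }
                ; identity = (λ x → ≡⇒≡[mod] (ℤₚ.+-identityˡ x)) , (λ x → ≡⇒≡[mod] (ℤₚ.+-identityʳ x))
                }
              ; inverse = (λ x → ≡⇒≡[mod] (ℤₚ.+-inverseˡ x)) , (λ x → ≡⇒≡[mod] (ℤₚ.+-inverseʳ x))
              ; ⁻¹-cong = ≡[mod]-‿cong
              }
            ; comm = λ x y → ≡⇒≡[mod] (ℤₚ.+-comm x y)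
            }
          ; *-cong = ≡[mod]-*-cong
          ; *-assoc = λ x y z → ≡⇒≡[mod] (ℤₚ.*-assoc x y z)
          ; *-identity = (λ x → ≡⇒≡[mod] (ℤₚ.*-identityˡ x)) , (λ x → ≡⇒≡[mod] (ℤₚ.*-identityʳ x))
          ; distrib = (λ x y z → ≡⇒≡[mod] (ℤₚ.*-distribˡ-+ x y z)) , (λ x y z → ≡⇒≡[mod] (ℤₚ.*-distribʳ-+ x y z))
          }
        ; *-comm = λ x y → ≡⇒≡[mod] (ℤₚ.*-comm x y)
        }
      }

    reduction : IsHomomorphism ℤₚ.+-*-commutativeRing ℤ/ id
    reduction = isHomomorphism {ℤₚ.+-*-commutativeRing} {ℤ/} ≡⇒≡[mod] (λ _ _ → ≡⇒≡[mod] refl) (λ _ _ → ≡⇒≡[mod] refl)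
      (λ _ → ≡⇒≡[mod] refl) (≡⇒≡[mod] refl) (≡⇒≡[mod] refl)

  ι-ℤ : ∀ z → IntegerMultiples.ι ℤₚ.+-*-commutativeRing z ≡ z
  ι-ℤ (+ n)    = ι-ℕ n
    where
    ι-ℕ : ∀ n → IntegerMultiples.ι ℤₚ.+-*-commutativeRing (+ n) ≡ + n
    ι-ℕ zero    = refl
    ι-ℕ (suc n) = ≡.trans (cong (λ z → 1ℤ + z) (ι-ℕ n)) (≡.sym (ℤₚ.pos-+ 1 n))
  ι-ℤ -[1+ n ] = cong -_ (ι-ℤ (+ suc n))

  ι-ℤ/ : ∀ n z → IntegerMultiples.ι (ℤ/ n) z ≡ z [mod n ]
  ι-ℤ/ n z = ≡[mod]-trans n (≡[mod]-sym n ι-reduction) (≡⇒≡[mod] n (ι-ℤ z))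
    where
    ι-reduction : IntegerMultiples.ι ℤₚ.+-*-commutativeRing z ≡ IntegerMultiples.ι (ℤ/ n) z [mod n ]
    ι-reduction = ι-homo (reduction n) z

  module _ {p : ℕ} (prime : Prime p) where

    prime-∣-* : ∀ x y → + p ∣ x * y → + p ∣ x ⊎ + p ∣ y
    prime-∣-* x y p∣xy = Sum.map ∣ᵤ⇒∣ ∣ᵤ⇒∣
      (euclidsLemma ℤ.∣ x ∣ ℤ.∣ y ∣ prime (≡.subst (λ n → p ℕ∣.∣ n) (ℤₚ.abs-* x y) (∣⇒∣ᵤ p∣xy)))

    prime-∣-square : ∀ x → + p ∣ x * x → + p ∣ x
    prime-∣-square x p∣x² = Sum.[ id , id ] (prime-∣-* x x p∣x²)

    prime-∤-small : ∀ {k} → 0 ℕ.< k → k ℕ.< p → ¬ (+ p ∣ + k)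
    prime-∤-small {suc k} _ k<p p∣k = ℕₚ.<⇒≱ k<p (ℕ∣.∣⇒≤ (∣⇒∣ᵤ p∣k))

    prime²-∣-*⇒∣ : ∀ x → + p * + p ∣ + p * x → + p ∣ x
    prime²-∣-*⇒∣ x = *-cancelˡ-∣ (+ p) {{prime⇒nonZero prime}}

module SignProducts where
  open QuadraticExtensions
  open IntegerMultiples using (ι)
  open Congruences
  open import Algebra.Bundles using (CommutativeRing)
  open import Data.Integer.Base as ℤ using (+_; 0ℤ; 1ℤ; _+_; _*_; -_; _-_)
  import Data.Integer.Properties as ℤₚ
  open import Data.Integer.Divisibility.Signed
    using (_∣_; divides; ∣-refl; ∣-trans; ∣m+n∣m⇒∣n; ∣m∣n⇒∣m+n; ∣m⇒∣-m; ∣m⇒∣m*n)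
  open import Data.Integer.Tactic.RingSolver using (solve-∀)
  open import Data.List.Base using (List; []; _∷_; _++_; length)
  open import Data.List.Relation.Unary.All using (All; []; _∷_)
  open import Data.Nat.Base as ℕ using (zero; suc)
  import Data.Nat.Properties as ℕₚ
  open import Data.Nat.Primality using (Prime)
  open import Data.Product.Base using (_,_; proj₁; proj₂)
  open import Data.Sum.Base as Sum using (inj₁; inj₂)
  open import Function.Base using (_∘_)
  open import Relation.Binary.PropositionalEquality as ≡ using (_≡_; cong; cong₂)
  open import Relation.Nullary.Negation.Core using (¬_)

  module _ (M b : ℤ) where

    -- The product over all sign vectors ε ∈ {±1}ᴸ of (z + (ε₁ + ⋯ + ε_L) M)² − b.
    signProduct : ℕ → ℤ → ℤ
    signProduct zero    z = z * z - b
    signProduct (suc L) z = signProduct L (z + M) * signProduct L (z - M)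

  private
    shift₀ : ∀ z M → z - 0ℤ * M + 0ℤ * M ≡ z
    shift₀ = solve-∀
    shift₊ : ∀ z M L j → (z + M) - L * M + j * M ≡ z - (1ℤ + L) * M + (+ 2 + j) * M
    shift₊ = solve-∀
    shift₋ : ∀ z M L j → (z - M) - L * M + j * M ≡ z - (1ℤ + L) * M + j * M
    shift₋ = solve-∀
    shift-far : ∀ z M L r j → (z - M) - L * M + j * M ≡ (z + (1ℤ + L) * M) - (r + + 2) * M + (j + r - + 2 * L) * M
    shift-far = solve-∀
    square-split : ∀ z b → z * z ≡ (z * z - b) + b
    square-split = solve-∀
    top-shift : ∀ z M L → (z + M) + L * M ≡ z + (1ℤ + L) * M
    top-shift = solve-∀
    b-split : ∀ z b → b ≡ z * z - (z * z - b)
    b-split = solve-∀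
    +[a-a]* : ∀ x a m → x + (a - a) * m ≡ x
    +[a-a]* = solve-∀
    factor-out : ∀ k Q Y → (k * Q) * Y ≡ Q * (k * Y)
    factor-out = solve-∀
    reassoc : ∀ k Q → (k * Q) * Q ≡ k * (Q * Q)
    reassoc = solve-∀

  module _ {q : ℕ} (prime : Prime q) {M : ℤ} (q∤M : ¬ (+ q ∣ M)) where
    private
      Q = + q
      P = signProduct M (Q * (M * M))

      Q∣b : Q ∣ Q * (M * M)
      Q∣b = ∣m⇒∣m*n (M * M) ∣-refl

      sucL : ∀ L → + suc L ≡ 1ℤ + + L
      sucL L = ℤₚ.pos-+ 1 L

    q∤signProduct : ∀ L z → (∀ j → j ℕ.≤ 2 ℕ.* L → ¬ (Q ∣ z - + L * M + + j * M)) → ¬ (Q ∣ P L z)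
    q∤signProduct zero z q∤z Q∣P = q∤z 0 ℕ.z≤n (≡.subst (Q ∣_) (≡.sym (shift₀ z M)) Q∣z)
      where
      Q∣z : Q ∣ z
      Q∣z = prime-∣-square prime z (≡.subst (Q ∣_) (≡.sym (square-split z (Q * (M * M)))) (∣m∣n⇒∣m+n Q∣P Q∣b))
    q∤signProduct (suc L) z q∤shifts Q∣P with prime-∣-* prime (P L (z + M)) (P L (z - M)) Q∣P
    ... | inj₁ Q∣P₊ = q∤signProduct L (z + M) q∤shifts₊ Q∣P₊
      where
      q∤shifts₊ : ∀ j → j ℕ.≤ 2 ℕ.* L → ¬ (Q ∣ (z + M) - + L * M + + j * M)
      q∤shifts₊ j j≤2L = q∤shifts (2 ℕ.+ j)
        (ℕₚ.≤-trans (ℕₚ.+-monoʳ-≤ 2 j≤2L) (ℕₚ.≤-reflexive (≡.sym (ℕₚ.*-suc 2 L))))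
        ∘ ≡.subst (Q ∣_) (≡.trans (shift₊ z M (+ L) (+ j))
            (cong₂ (λ a c → z - a * M + c * M) (≡.sym (sucL L)) (≡.sym (ℤₚ.pos-+ 2 j))))
    ... | inj₂ Q∣P₋ = q∤signProduct L (z - M) q∤shifts₋ Q∣P₋
      where
      q∤shifts₋ : ∀ j → j ℕ.≤ 2 ℕ.* L → ¬ (Q ∣ (z - M) - + L * M + + j * M)
      q∤shifts₋ j j≤2L = q∤shifts j (ℕₚ.≤-trans j≤2L (ℕₚ.*-monoʳ-≤ 2 (ℕₚ.n≤1+n L)))
        ∘ ≡.subst (Q ∣_) (≡.trans (shift₋ z M (+ L) (+ j)) (cong (λ a → z - a * M + + j * M) (≡.sym (sucL L))))

    q∥signProduct : ∀ L z → 2 ℕ.* L ℕ.+ 2 ℕ.< q → Q * Q ∣ z + + L * M → Q ∣ P L z × ¬ (Q * Q ∣ P L z)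
    q∥signProduct zero z _ Q²∣z+0 = Q∣P , Q²∤P
      where
      Q²∣z : Q * Q ∣ z
      Q²∣z = ≡.subst (Q * Q ∣_) (ℤₚ.+-identityʳ z) Q²∣z+0
      Q∣P : Q ∣ P 0 z
      Q∣P = ∣m∣n⇒∣m+n (∣m⇒∣m*n z (∣-trans (∣m⇒∣m*n Q ∣-refl) Q²∣z)) (∣m⇒∣-m Q∣b)
      Q²∤P : ¬ (Q * Q ∣ P 0 z)
      Q²∤P Q²∣P = q∤M (prime-∣-square prime M (prime²-∣-*⇒∣ prime (M * M)
        (≡.subst (Q * Q ∣_) (≡.sym (b-split z (Q * (M * M)))) (∣m∣n⇒∣m+n (∣m⇒∣m*n z Q²∣z) (∣m⇒∣-m Q²∣P)))))
    q∥signProduct (suc L) z 2L+4<q Q²∣top = ∣m⇒∣m*n (P L (z - M)) Q∣P₊ , Q²∤P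
      where
      2L+2<q : 2 ℕ.* L ℕ.+ 2 ℕ.< q
      2L+2<q = ℕₚ.≤-<-trans (ℕₚ.+-monoˡ-≤ 2 (ℕₚ.*-monoʳ-≤ 2 (ℕₚ.n≤1+n L))) 2L+4<q
      top≡ : z + + suc L * M ≡ (z + M) + + L * M
      top≡ = ≡.trans (cong (λ a → z + a * M) (sucL L)) (≡.sym (top-shift z M (+ L)))
      Q∣top : Q ∣ z + (1ℤ + + L) * M
      Q∣top = ∣-trans (∣m⇒∣m*n Q ∣-refl) (≡.subst (Q * Q ∣_) (cong (λ a → z + a * M) (sucL L)) Q²∣top)
      Q∣P₊ : Q ∣ P L (z + M)
      Q∣P₊ = proj₁ (q∥signProduct L (z + M) 2L+2<q (≡.subst (Q * Q ∣_) top≡ Q²∣top))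
      Q²∤P₊ : ¬ (Q * Q ∣ P L (z + M))
      Q²∤P₊ = proj₂ (q∥signProduct L (z + M) 2L+2<q (≡.subst (Q * Q ∣_) top≡ Q²∣top))
      q∤shifts₋ : ∀ j → j ℕ.≤ 2 ℕ.* L → ¬ (Q ∣ (z - M) - + L * M + + j * M)
      q∤shifts₋ j j≤2L Q∣shift = Sum.[ q∤r+2 , q∤M ] (prime-∣-* prime (+ r + + 2) M Q∣[r+2]M)
        where
        r = 2 ℕ.* L ℕ.∸ j
        2L≡j+r : + 2 * + L ≡ + j + + r
        2L≡j+r = ≡.trans (≡.sym (ℤₚ.pos-* 2 L)) (≡.trans (cong +_ (≡.sym (ℕₚ.m+[n∸m]≡n j≤2L))) (ℤₚ.pos-+ j r))
        T = z + (1ℤ + + L) * M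
        shift≡ : (z - M) - + L * M + + j * M ≡ T - (+ r + + 2) * M
        shift≡ = ≡.trans (shift-far z M (+ L) (+ r) (+ j))
          (≡.trans (cong (λ t → T - (+ r + + 2) * M + (+ j + + r - t) * M) 2L≡j+r)
                   (+[a-a]* (T - (+ r + + 2) * M) (+ j + + r) M))
        Q∣[r+2]M : Q ∣ (+ r + + 2) * M
        Q∣[r+2]M = ≡.subst (Q ∣_) (ℤₚ.neg-involutive _)
          (∣m⇒∣-m (∣m+n∣m⇒∣n (≡.subst (Q ∣_) shift≡ Q∣shift) Q∣top))
        q∤r+2 : ¬ (Q ∣ + r + + 2)
        q∤r+2 = prime-∤-small prime (ℕₚ.<-≤-trans (ℕ.s≤s ℕ.z≤n) (ℕₚ.m≤n+m 2 r))
          (ℕₚ.≤-<-trans (ℕₚ.+-monoˡ-≤ 2 (ℕₚ.m∸n≤m (2 ℕ.* L) j)) 2L+2<q)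
          ∘ ≡.subst (Q ∣_) (≡.sym (ℤₚ.pos-+ r 2))
      Q∤P₋ : ¬ (Q ∣ P L (z - M))
      Q∤P₋ = q∤signProduct L (z - M) q∤shifts₋
      Q²∤P : ¬ (Q * Q ∣ P (suc L) z)
      Q²∤P Q²∣P = Sum.[ Q²∤P₊ ∘ Q∣k⇒Q²∣P₊ , Q∤P₋ ] (prime-∣-* prime k P₋ Q∣kP₋)
        where
        P₋ = P L (z - M)
        open _∣_ Q∣P₊ renaming (quotient to k; equality to P₊≡kQ)
        Q∣kP₋ : Q ∣ k * P₋
        Q∣kP₋ = prime²-∣-*⇒∣ prime (k * P₋)
          (≡.subst (Q * Q ∣_) (≡.trans (cong (_* P₋) P₊≡kQ) (factor-out k Q P₋)) Q²∣P)
        Q∣k⇒Q²∣P₊ : Q ∣ k → Q * Q ∣ P L (z + M)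
        Q∣k⇒Q²∣P₊ (divides k′ k≡k′Q) = divides k′ (≡.trans P₊≡kQ (≡.trans (cong (_* Q) k≡k′Q) (reassoc k′ Q)))

  module _ (n M b₀ : ℤ) where
    private
      open module ℤ/n = CommutativeRing (ℤ/ n) using () renaming (_≈_ to _≈ₙ_)

    norm-signProduct : ∀ rest → All (λ b → M * M ≡ b [mod n ]) rest →
                       ∀ z → norm (ℤ/ n) (rest ++ b₀ ∷ []) z ≈ₙ signProduct M b₀ (length rest) z
    norm-signProduct [] [] z = ℤ/n.+-congˡ {z * z} (ℤ/n.-‿cong {ι (ℤ/ n) b₀ * (1ℤ * 1ℤ)} {b₀} (ℤ/n.trans
      (ℤ/n.*-identityʳ (ι (ℤ/ n) b₀)) (ι-ℤ/ n b₀)))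
    norm-signProduct (b ∷ rest) (M²≡b ∷ M²≡rest) z = ℤ/n.trans
      (norm-split (ℤ/ n) {b} (rest ++ b₀ ∷ []) z {M} (ℤ/n.trans M²≡b (ℤ/n.sym (ι-ℤ/ n b))))
      (ℤ/n.*-cong (norm-signProduct rest M²≡rest (z + M)) (norm-signProduct rest M²≡rest (z - M)))

module NextElement where
  open QuadraticExtensions
  open IntegerMultiples using (ι)
  open Congruences
  open SignProducts
  open import Level using (0ℓ)
  open import Algebra.Bundles using (CommutativeRing)
  open import Data.Integer.Base as ℤ using (+_; -[1+_]; 0ℤ; 1ℤ; _+_; _*_; -_; _-_)
  import Data.Integer.Properties as ℤₚ
  open import Data.Integer.Divisibility.Signed
    using (_∣_; divides; ∣-refl; ∣-trans; ∣m⇒∣m*n; ∣m∣n⇒∣m+n; ∣m⇒∣-m; ∣⇒∣ᵤ)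
  open import Data.Integer.Tactic.RingSolver using (solve-∀)
  open import Data.List.Base using (List; []; _∷_; _++_; length; map)
  open import Data.List.Membership.Propositional using (_∈_)
  open import Data.List.Membership.Propositional.Properties using (∈-map⁺; ∈-++⁺ˡ)
  open import Data.List.Properties using (length-map)
  open import Data.List.Relation.Unary.All as All using (All; []; _∷_)
  open import Data.List.Relation.Unary.All.Properties using (map⁺)
  open import Data.List.Relation.Unary.Any using (here; there)
  open import Data.Nat.Base as ℕ using (suc)
  open import Data.Nat.Coprimality using (Coprime; coprime-Bézout)
  import Data.Nat.Divisibility as ℕ∣
  open import Data.Nat.GCD using (module Bézout)
  open import Data.Nat.Primality using (Prime; ¬prime[1]; prime⇒nonTrivial)
  import Data.Nat.Properties as ℕₚ
  open import Data.Product.Base using (Σ; Σ-syntax; _,_; proj₁; proj₂)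
  open import Data.Sum.Base using (_⊎_; inj₁; inj₂)
  open import Function.Base using (_∘_)
  open import Relation.Binary.PropositionalEquality as ≡ using (_≡_; refl; cong; cong₂)
  open import Relation.Nullary.Negation.Core using (¬_)

  private
    pos-mul : ∀ a b → + a * + b ≡ + (a ℕ.* b)
    pos-mul a b = ≡.sym (ℤₚ.pos-* a b)
    1+Y-1 : ∀ Y → (1ℤ + Y) - 1ℤ ≡ Y
    1+Y-1 = solve-∀
    X+1 : ∀ X Y → 1ℤ + X ≡ Y → X - -[1+ 0 ] ≡ Y
    X+1 X Y eq = ≡.trans (solve-∀′ X) eq
      where
      solve-∀′ : ∀ X → X - -[1+ 0 ] ≡ 1ℤ + X
      solve-∀′ = solve-∀
    regroup : ∀ x q → x * x * (q * q) ≡ (x * q) * (x * q)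
    regroup = solve-∀

  module _ {m : ℕ} where
    private
      module ℤ/m = CommutativeRing (ℤ/ (+ m))

    ±1-square : ∀ {u} → u ≡ 1ℤ [mod + m ] ⊎ u ≡ -[1+ 0 ] [mod + m ] → u * u ≡ 1ℤ [mod + m ]
    ±1-square (inj₁ u≡1)  = ℤ/m.*-cong u≡1 u≡1
    ±1-square (inj₂ u≡-1) = ℤ/m.*-cong u≡-1 u≡-1

  square-inverse : ∀ {q m} → Coprime q m → Σ[ β ∈ ℤ ] β * (+ q * + q) ≡ 1ℤ [mod + m ]
  square-inverse {q} {m} q⊥m with coprime-Bézout q⊥m
  ... | Bézout.+- x y 1+ym≡xq = + x * + x ,
    ≡[mod]-trans (+ m) (≡⇒≡[mod] (+ m) (regroup (+ x) (+ q))) (±1-square {u = + x * + q} (inj₁ (congruent (divides (+ y)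
      (≡.trans (cong (_- 1ℤ) xq≡1+ym) (1+Y-1 (+ y * + m)))))))
    where
    xq≡1+ym : + x * + q ≡ 1ℤ + + y * + m
    xq≡1+ym = ≡.trans (pos-mul x q) (≡.trans (cong +_ (≡.sym 1+ym≡xq))
                (≡.trans (ℤₚ.pos-+ 1 (y ℕ.* m)) (cong (ℤ._+_ 1ℤ) (≡.sym (pos-mul y m)))))
  ... | Bézout.-+ x y 1+xq≡ym = + x * + x ,
    ≡[mod]-trans (+ m) (≡⇒≡[mod] (+ m) (regroup (+ x) (+ q))) (±1-square {u = + x * + q} (inj₂ (congruent (divides (+ y)
      (X+1 (+ x * + q) (+ y * + m) 1+xq≡ym′)))))
    where
    1+xq≡ym′ : 1ℤ + + x * + q ≡ + y * + m
    1+xq≡ym′ = ≡.trans (cong (ℤ._+_ 1ℤ) (pos-mul x q)) (≡.trans (≡.sym (ℤₚ.pos-+ 1 (x ℕ.* q)))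
                 (≡.trans (cong +_ 1+xq≡ym) (≡.sym (pos-mul y m))))

  IsIntegralNorm : ℤ → ℤ → Set
  IsIntegralNorm b y = Σ[ U ∈ ℤ ] Σ[ V ∈ ℤ ] y ≡ U * U - b * (V * V)

  private
    ℤ-ring : CommutativeRing 0ℓ 0ℓ
    ℤ-ring = ℤₚ.+-*-commutativeRing

    0≤square : ∀ i → 0ℤ ℤ.≤ i * i
    0≤square (+ n)    = ≡.subst (0ℤ ℤ.≤_) (ℤₚ.pos-* n n) (ℤ.+≤+ ℕ.z≤n)
    0≤square -[1+ n ] = ℤ.+≤+ ℕ.z≤n

    0≤* : ∀ {i j} → 0ℤ ℤ.≤ i → 0ℤ ℤ.≤ j → 0ℤ ℤ.≤ i * j
    0≤* {+ m} {+ n} _ _ = ≡.subst (0ℤ ℤ.≤_) (ℤₚ.pos-* m n) (ℤ.+≤+ ℕ.z≤n)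

    M²-M²Q² : ∀ M Q → M * M - - (M * M * (Q * Q - 1ℤ)) ≡ (M * M) * (Q * Q)
    M²-M²Q² = solve-∀
    M²-M²A : ∀ M A → M * M - M * M * A ≡ - (M * M) * (A - 1ℤ)
    M²-M²A = solve-∀
    y-1 : ∀ β Q M L → β * (Q * Q) - M * L - 1ℤ ≡ (β * (Q * Q) - 1ℤ) + - L * M
    y-1 = solve-∀
    y+LM : ∀ β Q M L → β * (Q * Q) - M * L + L * M ≡ β * (Q * Q)
    y+LM = solve-∀
    M²A : ∀ M A → M * M * A ≡ (M * A) * M
    M²A = solve-∀
    -c : ∀ M Q → - (M * M * (Q * Q - 1ℤ)) ≡ (- (M * (Q * Q - 1ℤ))) * M
    -c = solve-∀
    QM² : ∀ Q M → Q * (M * M) ≡ (Q * M) * M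
    QM² = solve-∀
    norm-M²A : ∀ U V M A → U * U - M * M * A * (V * V) ≡ U * U - A * ((M * V) * (M * V))
    norm-M²A = solve-∀
    norm--c : ∀ U V c → U * U - - c * (V * V) ≡ U * U + c * (V * V)
    norm--c = solve-∀
    A-[A-B] : ∀ A B → A - (A - B) ≡ B
    A-[A-B] = solve-∀
    A-B+B : ∀ A B → (A - B) + B ≡ A
    A-B+B = solve-∀
    interchange : ∀ j Q → (j * Q) * (j * Q) ≡ (j * j) * (Q * Q)
    interchange = solve-∀

  module _ {q : ℕ} (prime : Prime q) {m : ℕ} (q⊥m : Coprime q m) (As : List ℤ)
           (As≡1 : All (λ A → A ≡ 1ℤ [mod + q * + q ]) As)
           (q-large : 2 ℕ.* suc (length As) ℕ.+ 2 ℕ.< q) where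
    private
      Q M c b₀ β y A : ℤ
      Q = + q
      M = + m
      c = M * M * (Q * Q - 1ℤ)
      b₀ = Q * (M * M)
      rest F : List ℤ
      rest = - c ∷ map (M * M *_) As
      F = rest ++ b₀ ∷ []
      L : ℕ
      L = length rest
      β = proj₁ (square-inverse q⊥m)
      y = β * (Q * Q) - M * + L
      A = norm ℤ-ring F y
      module ℤ/M = CommutativeRing (ℤ/ M)
      module ℤ/Q² = CommutativeRing (ℤ/ (Q * Q))

      F≡0 : All (λ b → ι (ℤ/ M) b ≡ 0ℤ [mod M ]) F
      F≡0 = multiple (- (M * (Q * Q - 1ℤ))) (-c M Q) ∷ rest≡0 As
        where
        multiple : ∀ {b} k → b ≡ k * M → ι (ℤ/ M) b ≡ 0ℤ [mod M ]
        multiple {b} k b≡kM = ℤ/M.trans (ι-ℤ/ M b) (congruent (divides k (≡.trans (ℤₚ.+-identityʳ b) b≡kM)))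
        rest≡0 : ∀ Bs → All (λ b → ι (ℤ/ M) b ≡ 0ℤ [mod M ]) (map (M * M *_) Bs ++ b₀ ∷ [])
        rest≡0 []       = multiple (Q * M) (QM² Q M) ∷ []
        rest≡0 (B ∷ Bs) = multiple (M * B) (M²A M B) ∷ rest≡0 Bs

      y≡1 : y ≡ 1ℤ [mod M ]
      y≡1 = congruent (divides (k + - + L) (≡.trans (y-1 β Q M (+ L))
        (≡.trans (cong (_+ - + L * M) βQ²-1≡kM) (≡.sym (ℤₚ.*-distribʳ-+ M k (- + L))))))
        where
          open _∣_ (divides-difference (proj₂ (square-inverse q⊥m))) renaming (quotient to k; equality to βQ²-1≡kM)

      A≡1 : A ≡ 1ℤ [mod M ]
      A≡1 = ℤ/M.trans (norm-homo (reduction M) F y) (norm≈1 (ℤ/ M) F F≡0 y≡1)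

      rest≡M² : All (λ b → M * M ≡ b [mod Q * Q ]) rest
      rest≡M² = congruent (divides (M * M) (M²-M²Q² M Q)) ∷ map⁺ (All.map M²≡M²A As≡1)
        where
        M²≡M²A : ∀ {A} → A ≡ 1ℤ [mod Q * Q ] → M * M ≡ M * M * A [mod Q * Q ]
        M²≡M²A {A} (congruent (divides k A-1≡kQ²)) = congruent (divides (- (M * M) * k)
          (≡.trans (M²-M²A M A) (≡.trans (cong (- (M * M) *_) A-1≡kQ²) (≡.sym (ℤₚ.*-assoc (- (M * M)) k (Q * Q))))))

      A≡signProduct : A ≡ signProduct M b₀ L y [mod Q * Q ]
      A≡signProduct = ℤ/Q².trans (norm-homo (reduction (Q * Q)) F y) (norm-signProduct (Q * Q) M b₀ rest rest≡M² y)

      q∤M : ¬ (Q ∣ M)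
      q∤M Q∣M = ¬prime[1] (≡.subst Prime (q⊥m (ℕ∣.∣-refl , ∣⇒∣ᵤ Q∣M)) prime)

      q∥signProduct-y : Q ∣ signProduct M b₀ L y × ¬ (Q * Q ∣ signProduct M b₀ L y)
      q∥signProduct-y = q∥signProduct prime q∤M L y
        (≡.subst (λ n → 2 ℕ.* suc n ℕ.+ 2 ℕ.< q) (≡.sym (length-map (M * M *_) As)) q-large)
        (divides β (y+LM β Q M (+ L)))

      Q∣A : Q ∣ A
      Q∣A = ≡.subst (Q ∣_) (A-B+B A (signProduct M b₀ L y))
        (∣m∣n⇒∣m+n (∣-trans (∣m⇒∣m*n Q ∣-refl) (divides-difference A≡signProduct)) (proj₁ q∥signProduct-y))

      Q²∤A : ¬ (Q * Q ∣ A)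
      Q²∤A Q²∣A = proj₂ q∥signProduct-y (≡.subst (Q * Q ∣_) (A-[A-B] A (signProduct M b₀ L y))
        (∣m∣n⇒∣m+n Q²∣A (∣m⇒∣-m (divides-difference A≡signProduct))))

      isNorm : ∀ {Aᵢ} → Aᵢ ∈ As → IsIntegralNorm Aᵢ A
      isNorm {Aᵢ} Aᵢ∈As = U , M * V ,
        ≡.trans A≡N (≡.trans (cong (λ t → U * U - t * (V * V)) (ι-ℤ (M * M * Aᵢ))) (norm-M²A U V M Aᵢ))
        where
        open Σ (norm-isNorm ℤ-ring F y (there (∈-++⁺ˡ (∈-map⁺ (M * M *_) Aᵢ∈As)))) renaming (proj₁ to UV; proj₂ to A≡N)
        U = proj₁ UV
        V = proj₂ UV

      0≤A : 0ℤ ℤ.≤ A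
      0≤A = ≡.subst (0ℤ ℤ.≤_)
        (≡.sym (≡.trans A≡N (≡.trans (cong (λ t → U * U - t * (V * V)) (ι-ℤ (- c))) (norm--c U V c))))
        (ℤₚ.+-mono-≤ (0≤square U) (0≤* (0≤* (0≤square M) (ℤₚ.i≤j⇒0≤j-i 1≤Q²)) (0≤square V)))
        where
        open Σ (norm-isNorm ℤ-ring F y (here refl)) renaming (proj₁ to UV; proj₂ to A≡N)
        U = proj₁ UV
        V = proj₂ UV
        1≤Q² : 1ℤ ℤ.≤ Q * Q
        1≤Q² = ≡.subst (1ℤ ℤ.≤_) (ℤₚ.pos-* q q) (ℤ.+≤+ (ℕₚ.*-mono-≤ q≥1 q≥1))
          where
            q≥1 = ℕₚ.<⇒≤ (ℕ.nonTrivial⇒n>1 q {{prime⇒nonTrivial prime}})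

    nextElement : Σ[ a ∈ ℕ ] (+ a ≡ 1ℤ [mod + m ]) × ¬ IsSquareN a × All (λ Aᵢ → IsIntegralNorm Aᵢ (+ a)) As
    nextElement = ℤ.∣ A ∣ , ≡.subst (_≡ 1ℤ [mod M ]) (≡.sym +a≡A) A≡1 , nonsquare ,
                  All.tabulate (λ {Aᵢ} → ≡.subst (IsIntegralNorm Aᵢ) (≡.sym +a≡A) ∘ isNorm)
      where
      +a≡A : + ℤ.∣ A ∣ ≡ A
      +a≡A = ℤₚ.0≤i⇒+∣i∣≡i 0≤A
      nonsquare : ¬ IsSquareN ℤ.∣ A ∣
      nonsquare (k , k*k≡a) = Q²∤A (≡.subst (Q * Q ∣_) A≡k*k (square-∣ (prime-∣-square prime (+ k) (≡.subst (Q ∣_) (≡.sym A≡k*k) Q∣A))))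
        where
        A≡k*k : + k * + k ≡ A
        A≡k*k = ≡.trans (≡.sym (ℤₚ.pos-* k k)) (≡.trans (cong +_ k*k≡a) +a≡A)
        square-∣ : Q ∣ + k → Q * Q ∣ + k * + k
        square-∣ (divides j k≡jQ) = divides (j * j) (≡.trans (cong₂ _*_ k≡jQ k≡jQ) (interchange j Q))

module Primes where
  open import Data.List.Base using (List; []; _∷_; length)
  open import Data.List.Relation.Unary.All as All using (All; []; _∷_)
  open import Data.List.Relation.Unary.AllPairs using (AllPairs; []; _∷_)
  open import Data.Nat.Base as ℕ using (zero; suc; _+_; _≤_; _<_; _!; z≤n; s≤s)
  open import Data.Nat.Divisibility using (_∣_; ∣-trans; m∣m*n; m≤n⇒m!∣n!; ∣m+n∣m⇒∣n; ∣1⇒≡1)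
  open import Data.Nat.ListAction using (product)
  open import Data.Nat.Primality using (Prime; prime⇒nonZero; ¬prime[1])
  open import Data.Nat.Primality.Factorisation using (factorise)
  import Data.Nat.Properties as ℕₚ
  open import Data.Product.Base using (Σ-syntax; _,_)
  open import Relation.Binary.PropositionalEquality as ≡ using (_≡_; _≢_; refl; cong)
  open import Relation.Nullary.Decidable using (yes; no)
  open import Relation.Nullary.Negation using (contradiction)

  prime-factor : ∀ {n} → 2 ≤ n → Σ[ p ∈ ℕ ] Prime p × p ∣ n
  prime-factor {n} 2≤n with factorise n {{ℕ.>-nonZero (ℕₚ.<-trans (s≤s z≤n) 2≤n)}}
  ... | record { factors = [] ; isFactorisation = n≡1 } = contradiction (≡.sym n≡1) (ℕₚ.<⇒≢ 2≤n)
  ... | record { factors = p ∷ ps ; isFactorisation = n≡p*ps ; factorsPrime = p-prime ∷ _ } =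
    p , p-prime , ≡.subst (p ∣_) (≡.sym n≡p*ps) (m∣m*n (product ps))

  ∣n! : ∀ {k n} → 0 < k → k ≤ n → k ∣ n !
  ∣n! {suc k} _ k≤n = ∣-trans (m∣m*n (k !)) (m≤n⇒m!∣n! k≤n)

  -- Euclid: a prime factor of n! + 1 exceeds n.
  prime-above : ∀ n → Σ[ p ∈ ℕ ] Prime p × n < p
  prime-above n with prime-factor {n ! + 1} (ℕₚ.+-monoˡ-≤ 1 (ℕₚ.1≤n! n))
  ... | p , p-prime , p∣n!+1 with n ℕₚ.<? p
  ...   | yes n<p = p , p-prime , n<p
  ...   | no  n≮p = contradiction (≡.subst Prime (∣1⇒≡1 (∣m+n∣m⇒∣n p∣n!+1 p∣n!)) p-prime) ¬prime[1]
    where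
      p∣n! = ∣n! (ℕ.>-nonZero⁻¹ p {{prime⇒nonZero p-prime}}) (ℕₚ.≮⇒≥ n≮p)

  distinct-primes-above : ∀ k n → Σ[ ps ∈ List ℕ ] length ps ≡ k × All Prime ps × All (n <_) ps × AllPairs _≢_ ps
  distinct-primes-above zero    n = [] , refl , [] , [] , []
  distinct-primes-above (suc k) n with prime-above n
  ... | p , p-prime , n<p with distinct-primes-above k p
  ...   | ps , length≡k , primes , p<ps , distinct =
    p ∷ ps , cong suc length≡k , p-prime ∷ primes , n<p ∷ All.map (ℕₚ.<-trans n<p) p<ps ,
    All.map ℕₚ.<⇒≢ p<ps ∷ distinct

module Squarefree where
  open Primes
  open import Data.Nat.Base as ℕ using (zero; suc; _*_; _≤_; _<_; z≤n; s≤s)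
  open import Data.Nat.Coprimality using (Coprime; coprime-divisor)
  import Data.Nat.Coprimality as Coprime
  open import Data.Nat.Divisibility
  open import Data.Nat.Induction using (<-rec)
  open import Data.Nat.Primality using (Prime; prime⇒nonZero; prime⇒nonTrivial; prime⇒irreducible; euclidsLemma; ¬prime[1])
  import Data.Nat.Properties as ℕₚ
  open import Data.Nat.Tactic.RingSolver using (solve-∀)
  open import Data.Product.Base using (Σ-syntax; _,_)
  open import Data.Sum.Base using (_⊎_; inj₁; inj₂)
  open import Function.Base using (_∘_)
  open import Relation.Binary.PropositionalEquality as ≡ using (_≡_; _≢_; refl; cong)
  open import Relation.Nullary.Decidable using (yes; no; _×-dec_)
  open import Relation.Nullary.Negation using (¬_; contradiction)

  ¬squarefree[0] : ¬ SquarefreeN 0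
  ¬squarefree[0] sf with sf 2 (divides 0 refl)
  ... | ()

  squarefree⇒nonZero : ∀ {n} → SquarefreeN n → 0 < n
  squarefree⇒nonZero {zero}  sf = contradiction sf ¬squarefree[0]
  squarefree⇒nonZero {suc n} _  = s≤s z≤n

  squarefree-∣ : ∀ {c d} → SquarefreeN c → d ∣ c → SquarefreeN d
  squarefree-∣ sf d∣c p p²∣d = sf p (∣-trans p²∣d d∣c)

  squarefree⇒¬square : ∀ {n} → SquarefreeN n → 2 ≤ n → ∀ k → k * k ≢ n
  squarefree⇒¬square sf 2≤n k k²≡n with sf k (∣-reflexive k²≡n)
  ... | refl = ℕₚ.<⇒≢ 2≤n k²≡n

  module _ {r : ℕ} (r-prime : Prime r) where
    private instance _ = prime⇒nonZero r-prime

    prime²∣*⇒ : ∀ {x y} → r ∣ x → r * r ∣ x * y → r * r ∣ x ⊎ r ∣ y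
    prime²∣*⇒ {y = y} (divides x′ refl) r²∣x′ry with euclidsLemma x′ y r-prime
      (*-cancelˡ-∣ r (≡.subst (r * r ∣_) (solve-∀′ x′ r y) r²∣x′ry))
      where
      solve-∀′ : ∀ x′ r y → x′ * r * y ≡ r * (x′ * y)
      solve-∀′ = solve-∀
    ... | inj₁ r∣x′ = inj₁ (*-monoˡ-∣ r r∣x′)
    ... | inj₂ r∣y  = inj₂ r∣y

    prime∤squarefree-quotient : ∀ {c′} → SquarefreeN (c′ * r) → ¬ r ∣ c′
    prime∤squarefree-quotient sf r∣c′ = ¬prime[1] (≡.subst Prime (sf r (*-monoˡ-∣ r r∣c′)) r-prime)

  squarefree-* : ∀ {a b} → SquarefreeN a → SquarefreeN b → Coprime a b → SquarefreeN (a * b)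
  squarefree-* {a} {b} sa sb a⊥b zero 0∣ab with ℕₚ.m*n≡0⇒m≡0∨n≡0 a (0∣⇒≡0 0∣ab)
  ... | inj₁ refl = contradiction sa ¬squarefree[0]
  ... | inj₂ refl = contradiction sb ¬squarefree[0]
  squarefree-* sa sb a⊥b 1 _ = refl
  squarefree-* {a} {b} sa sb a⊥b p@(suc (suc _)) p²∣ab with prime-factor {p} (s≤s (s≤s z≤n))
  ... | r , r-prime , r∣p = contradiction (≡.subst Prime r≡1 r-prime) ¬prime[1]
    where
    r²∣ab : r * r ∣ a * b
    r²∣ab = ∣-trans (*-pres-∣ r∣p r∣p) p²∣ab
    r≡1 : r ≡ 1
    r≡1 with euclidsLemma a b r-prime (∣-trans (m∣m*n r) r²∣ab)
    ... | inj₁ r∣a with prime²∣*⇒ r-prime r∣a r²∣ab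
    ...   | inj₁ r²∣a = sa r r²∣a
    ...   | inj₂ r∣b  = a⊥b (r∣a , r∣b)
    r≡1 | inj₂ r∣b with prime²∣*⇒ r-prime r∣b (≡.subst (r * r ∣_) (ℕₚ.*-comm a b) r²∣ab)
    ...   | inj₁ r²∣b = sb r r²∣b
    ...   | inj₂ r∣a  = a⊥b (r∣a , r∣b)

  squarefree-∣-square : ∀ c → SquarefreeN c → ∀ k → c ∣ k * k → c ∣ k
  squarefree-∣-square = <-rec _ go
    where
    go : ∀ c → (∀ {c′} → c′ < c → SquarefreeN c′ → ∀ k → c′ ∣ k * k → c′ ∣ k) →
         SquarefreeN c → ∀ k → c ∣ k * k → c ∣ k
    go zero          _   sf _ _ = contradiction sf ¬squarefree[0]
    go (suc zero)    _   _  k _ = 1∣ k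
    go c@(suc (suc _)) rec sf k c∣k² with prime-factor {c} (s≤s (s≤s z≤n))
    ... | r , r-prime , divides c′ c≡c′r = ≡.subst (_∣ k) (≡.sym c≡c′r) c′r∣k
      where
      instance _ = prime⇒nonZero r-prime
      sf′ : SquarefreeN (c′ * r)
      sf′ = ≡.subst SquarefreeN c≡c′r sf
      r∣k : r ∣ k
      r∣k with euclidsLemma k k r-prime (∣-trans (≡.subst (r ∣_) (≡.sym c≡c′r) (n∣m*n c′)) c∣k²)
      ... | inj₁ r∣k = r∣k
      ... | inj₂ r∣k = r∣k
      open _∣_ r∣k renaming (quotient to k′; equality to k≡k′r)
      c′∣k′² : c′ ∣ k′ * k′
      c′∣k′² = coprime-divisor (Coprime.sym (prime⇒coprime′)) (*-cancelʳ-∣ r (≡.subst₂ _∣_ c≡c′r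
        (≡.trans (cong (λ t → t * t) k≡k′r) (solve-∀′ k′ r)) c∣k²))
        where
        solve-∀′ : ∀ k′ r → k′ * r * (k′ * r) ≡ r * (k′ * k′) * r
        solve-∀′ = solve-∀
        prime⇒coprime′ : Coprime r c′
        prime⇒coprime′ (d∣r , d∣c′) with prime⇒irreducible r-prime d∣r
        ... | inj₁ d≡1 = d≡1
        ... | inj₂ refl = contradiction d∣c′ (prime∤squarefree-quotient r-prime sf′)
      c′<c : c′ < c
      c′<c = ≡.subst (c′ <_) (≡.sym c≡c′r)
        (ℕₚ.m<m*n c′ r {{ℕ.≢-nonZero c′≢0}} (ℕ.nonTrivial⇒n>1 r {{prime⇒nonTrivial r-prime}}))
        where
        c′≢0 : c′ ≢ 0
        c′≢0 c′≡0 = ℕₚ.1+n≢0 (≡.trans c≡c′r (cong (_* r) c′≡0))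
      c′r∣k : c′ * r ∣ k
      c′r∣k = ≡.subst (c′ * r ∣_) (≡.sym k≡k′r) (*-monoˡ-∣ r (rec c′<c (squarefree-∣ sf′ (m∣m*n r)) k′ c′∣k′²))

  squarefree-decomposition : ∀ n → 0 < n → Σ[ t ∈ ℕ ] Σ[ a ∈ ℕ ] n ≡ t * t * a × SquarefreeN a
  squarefree-decomposition = <-rec _ go
    where
    go : ∀ n → (∀ {n′} → n′ < n → 0 < n′ → Σ[ t ∈ ℕ ] Σ[ a ∈ ℕ ] n′ ≡ t * t * a × SquarefreeN a) →
         0 < n → Σ[ t ∈ ℕ ] Σ[ a ∈ ℕ ] n ≡ t * t * a × SquarefreeN a
    go n rec 0<n with ℕₚ.anyUpTo? (λ p → (2 ℕₚ.≤? p) ×-dec (p * p ∣? n)) (suc n)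
    ... | yes (p , _ , 2≤p , divides n′ n≡n′p²) =
      let (t , a , n′≡t²a , sf) = rec n′<n 0<n′
      in p * t , a , ≡.trans n≡n′p² (≡.trans (cong (_* (p * p)) n′≡t²a) (solve-∀′ t a p)) , sf
      where
      solve-∀′ : ∀ t a p → t * t * a * (p * p) ≡ p * t * (p * t) * a
      solve-∀′ = solve-∀
      0<n′ : 0 < n′
      0<n′ = ℕₚ.n≢0⇒n>0 (λ n′≡0 → ℕₚ.<⇒≢ 0<n (≡.sym (≡.trans n≡n′p² (cong (_* (p * p)) n′≡0))))
      n′<n : n′ < n
      n′<n = ≡.subst (n′ <_) (≡.sym n≡n′p²) (ℕₚ.m<m*n n′ (p * p) {{ℕ.>-nonZero 0<n′}}
        (ℕₚ.<-≤-trans 2≤p (ℕₚ.m≤m*n p p {{ℕ.>-nonZero (ℕₚ.<-trans (s≤s z≤n) 2≤p)}})))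
    ... | no ∄p = 1 , n , ≡.sym (ℕₚ.+-identityʳ n) , sf
      where
      sf : SquarefreeN n
      sf zero    0∣n = contradiction (0∣⇒≡0 0∣n) (ℕₚ.<⇒≢ 0<n ∘ ≡.sym)
      sf 1       _   = refl
      sf p@(suc (suc _)) p²∣n = contradiction
        (p , s≤s (ℕₚ.≤-trans (ℕₚ.m≤m*n p p) (∣⇒≤ {{ℕ.>-nonZero 0<n}} p²∣n)) , s≤s (s≤s z≤n) , p²∣n) ∄p

module Family where
  open Congruences using (_≡_[mod_]; congruent; divides-difference)
  open NextElement using (IsIntegralNorm; nextElement)
  open Primes using (distinct-primes-above)
  open Squarefree using (squarefree-decomposition)
  open import Data.Fin.Base using (Fin; zero; suc)
  open import Data.Integer.Base as ℤ using (+_; 0ℤ; 1ℤ)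
  import Data.Integer.Properties as ℤₚ
  import Data.Integer.Divisibility.Signed as ℤ∣
  open import Data.Integer.Tactic.RingSolver using (solve-∀)
  open import Data.List.Base using (List; []; _∷_; _++_; length; map; lookup)
  open import Data.List.Membership.Propositional using (_∈_)
  open import Data.List.Membership.Propositional.Properties using (∈-map⁺; ∈-++⁺ˡ; ∈-++⁺ʳ; ∈-lookup)
  open import Data.List.Properties using (length-map)
  open import Data.List.Relation.Unary.All as All using (All; []; _∷_)
  open import Data.List.Relation.Unary.All.Properties using (map⁺; map⁻; ++⁺)
  open import Data.List.Relation.Unary.AllPairs as AllPairs using (AllPairs; []; _∷_)
  open import Data.Nat.Base as ℕ using (zero; suc; _≤_; _<_; z≤n; s≤s)
  open import Data.Nat.Coprimality using (Coprime)
  import Data.Nat.Coprimality as Coprime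
  open import Data.Nat.Divisibility as ℕ∣ using (_∣_; divides)
  open import Data.Nat.ListAction using (product)
  open import Data.Nat.ListAction.Properties using (∈⇒∣product)
  open import Data.Nat.Primality using (Prime; euclidsLemma; prime⇒irreducible; ¬prime[1])
  import Data.Nat.Properties as ℕₚ
  open import Data.Product.Base using (Σ-syntax; _,_; proj₁; proj₂)
  open import Data.Sum.Base as Sum using (inj₁; inj₂)
  open import Function.Base using (_∘_)
  open import Relation.Binary.Definitions using (Symmetric)
  open import Relation.Binary.PropositionalEquality as ≡ using (_≡_; _≢_; refl; cong)
  open import Relation.Nullary.Negation using (¬_; contradiction)

  ≡[mod]-∣ : ∀ {d n x y} → d ℤ∣.∣ n → x ≡ y [mod n ] → x ≡ y [mod d ]
  ≡[mod]-∣ d∣n x≡y = congruent (ℤ∣.∣-trans d∣n (divides-difference x≡y))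

  prime∤≡1 : ∀ {q b} → Prime q → + b ≡ 1ℤ [mod + q ] → ¬ q ∣ b
  prime∤≡1 {q} {b} q-prime b≡1 q∣b = ¬prime[1] (≡.subst Prime (ℕ∣.∣1⇒≡1 (ℤ∣.∣⇒∣ᵤ q∣1)) q-prime)
    where
    q∣1 : + q ℤ∣.∣ 1ℤ
    q∣1 = ≡.subst (+ q ℤ∣.∣_) (b-[b-1] (+ b)) (ℤ∣.∣m∣n⇒∣m-n {m = + b} (ℤ∣.∣ᵤ⇒∣ q∣b) (divides-difference b≡1))
      where
      b-[b-1] : ∀ b → b ℤ.- (b ℤ.- 1ℤ) ≡ 1ℤ
      b-[b-1] = solve-∀

  prime∤⇒coprime : ∀ {q m} → Prime q → ¬ q ∣ m → Coprime q m
  prime∤⇒coprime q-prime q∤m (d∣q , d∣m) with prime⇒irreducible q-prime d∣q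
  ... | inj₁ d≡1 = d≡1
  ... | inj₂ refl = contradiction d∣m q∤m

  prime∤product : ∀ {q} → Prime q → ∀ {xs} → All (λ x → ¬ q ∣ x) xs → ¬ q ∣ product xs
  prime∤product q-prime []         q∣1  = ¬prime[1] (≡.subst Prime (ℕ∣.∣1⇒≡1 q∣1) q-prime)
  prime∤product q-prime (q∤x ∷ q∤xs) q∣x*xs =
    Sum.[ q∤x , prime∤product q-prime q∤xs ] (euclidsLemma _ _ q-prime q∣x*xs)

  Follows : ℕ → ℕ → Set
  Follows y x = (+ y ≡ 1ℤ [mod + x ]) × IsIntegralNorm (+ x) (+ y)

  -- bs is built so far (newest first); the primes qs are reserved for the elements still to come.
  record PartialFamily (N : ℕ) (bs qs : List ℕ) : Set where
    field
      follows   : AllPairs Follows bs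
      nonsquare : All (λ b → ¬ IsSquareN b) bs
      ≡1        : All (λ b → All (λ q → + b ≡ 1ℤ [mod + q ℤ.* + q ]) qs) bs
      primes    : All Prime qs
      large     : All (λ q → 2 ℕ.* N ℕ.+ 2 < q) qs
      distinct  : AllPairs _≢_ qs
      size      : length bs ℕ.+ length qs ≡ N

  extend : ∀ {N bs q qs} → PartialFamily N bs (q ∷ qs) → Σ[ a ∈ ℕ ] PartialFamily N (a ∷ bs) qs
  extend {N} {bs} {q} {qs} F = a , record
    { follows   = All.tabulate (λ b∈bs → ≡[mod]-∣ (divisor (∈-++⁺ˡ b∈bs)) a≡1 , All.lookup (map⁻ a-norm) b∈bs) ∷ follows
    ; nonsquare = a-nonsquare ∷ nonsquare
    ; ≡1        = All.tabulate (λ q′∈qs → ≡[mod]-∣ (square-divisor q′∈qs) a≡1) ∷ All.map All.tail ≡1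
    ; primes    = All.tail primes
    ; large     = All.tail large
    ; distinct  = AllPairs.tail distinct
    ; size      = ≡.trans (≡.sym (ℕₚ.+-suc (length bs) (length qs))) size
    }
    where
    open PartialFamily F
    q-prime = All.head primes
    m = product (bs ++ map (λ q′ → q′ ℕ.* q′) qs)
    divisor : ∀ {x} → x ∈ bs ++ map (λ q′ → q′ ℕ.* q′) qs → + x ℤ∣.∣ + m
    divisor = ℤ∣.∣ᵤ⇒∣ ∘ ∈⇒∣product
    square-divisor : ∀ {q′} → q′ ∈ qs → + q′ ℤ.* + q′ ℤ∣.∣ + m
    square-divisor {q′} q′∈qs = ≡.subst (ℤ∣._∣ + m) (ℤₚ.pos-* q′ q′) (divisor (∈-++⁺ʳ bs (∈-map⁺ _ q′∈qs)))
    q∤q′² : ∀ {q′} → q ≢ q′ → Prime q′ → ¬ q ∣ q′ ℕ.* q′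
    q∤q′² {q′} q≢q′ q′-prime q∣q′² with prime⇒irreducible q′-prime (Sum.[ (λ x → x) , (λ x → x) ] (euclidsLemma q′ q′ q-prime q∣q′²))
    ... | inj₁ q≡1 = ¬prime[1] (≡.subst Prime q≡1 q-prime)
    ... | inj₂ q≡q′ = q≢q′ q≡q′
    q⊥m : Coprime q m
    q⊥m = prime∤⇒coprime q-prime (prime∤product q-prime (++⁺
      (All.map (λ b≡1 → prime∤≡1 q-prime (≡[mod]-∣ (ℤ∣.∣m⇒∣m*n (+ q) ℤ∣.∣-refl) (All.head b≡1))) ≡1)
      (map⁺ (All.zipWith (λ (q≢q′ , q′-prime) → q∤q′² q≢q′ q′-prime) (AllPairs.head distinct , All.tail primes)))))
    q-large : 2 ℕ.* suc (length (map +_ bs)) ℕ.+ 2 < q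
    q-large = ℕₚ.≤-<-trans (ℕₚ.+-monoˡ-≤ 2 (ℕₚ.*-monoʳ-≤ 2 (≡.subst (λ n → suc n ≤ N) (≡.sym (length-map +_ bs))
      (ℕₚ.≤-trans (ℕₚ.m≤m+n (suc (length bs)) (length qs))
        (ℕₚ.≤-reflexive (≡.trans (≡.sym (ℕₚ.+-suc (length bs) (length qs))) size))))))
      (All.head large)
    next = nextElement q-prime q⊥m (map +_ bs) (map⁺ (All.map All.head ≡1)) q-large
    a = proj₁ next
    a≡1 = proj₁ (proj₂ next)
    a-nonsquare = proj₁ (proj₂ (proj₂ next))
    a-norm = proj₂ (proj₂ (proj₂ next))

  complete : ∀ {N} qs {bs} → PartialFamily N bs qs → Σ[ bs′ ∈ List ℕ ] PartialFamily N bs′ []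
  complete []       F = _ , F
  complete (q ∷ qs) F = complete qs (proj₂ (extend F))

  followingFamily : ∀ N → Σ[ bs ∈ List ℕ ] length bs ≡ N × AllPairs Follows bs × All (λ b → ¬ IsSquareN b) bs
  followingFamily N with distinct-primes-above N (2 ℕ.* N ℕ.+ 2)
  ... | qs , length≡N , primes , large , distinct =
    let (bs , F) = complete qs (record
          { follows = [] ; nonsquare = [] ; ≡1 = [] ; primes = primes ; large = large
          ; distinct = distinct ; size = length≡N })
        open PartialFamily F
    in bs , ≡.trans (≡.sym (ℕₚ.+-identityʳ _)) size , follows , nonsquare

  IsRationalNorm : ℕ → ℕ → Set
  IsRationalNorm x y = Σ[ U ∈ ℤ ] Σ[ V ∈ ℤ ] Σ[ W ∈ ℤ ] W ≢ 0ℤ × + y ℤ.* (W ℤ.* W) ≡ U ℤ.* U ℤ.- + x ℤ.* (V ℤ.* V)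

  record Compatible (x y : ℕ) : Set where
    field
      coprime : Coprime x y
      norm    : IsRationalNorm x y
      norm′   : IsRationalNorm y x

  compatible-sym : Symmetric Compatible
  compatible-sym c = record { coprime = Coprime.sym coprime ; norm = norm′ ; norm′ = norm }
    where
      open Compatible c

  private
    i*i≡+∣i∣² : ∀ i → i ℤ.* i ≡ + (ℤ.∣ i ∣ ℕ.* ℤ.∣ i ∣)
    i*i≡+∣i∣² (+ n)    = ≡.sym (ℤₚ.pos-* n n)
    i*i≡+∣i∣² ℤ.-[1+ n ] = refl

    y*1 : ∀ y U x V → y ≡ U ℤ.* U ℤ.- x ℤ.* (V ℤ.* V) → y ℤ.* (1ℤ ℤ.* 1ℤ) ≡ U ℤ.* U ℤ.- x ℤ.* (V ℤ.* V)
    y*1 y U x V eq = ≡.trans (ℤₚ.*-identityʳ y) eq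
    swap-norm : ∀ y U x V → y ≡ U ℤ.* U ℤ.- x ℤ.* (V ℤ.* V) → x ℤ.* (V ℤ.* V) ≡ U ℤ.* U ℤ.- y ℤ.* (1ℤ ℤ.* 1ℤ)
    swap-norm y U x V refl = lemma x V U
      where
      lemma : ∀ x V U → x ℤ.* (V ℤ.* V) ≡ U ℤ.* U ℤ.- (U ℤ.* U ℤ.- x ℤ.* (V ℤ.* V)) ℤ.* (1ℤ ℤ.* 1ℤ)
      lemma = solve-∀
    U²-0 : ∀ U x → U ℤ.* U ℤ.- x ℤ.* (0ℤ ℤ.* 0ℤ) ≡ U ℤ.* U
    U²-0 = solve-∀

  follows⇒compatible : ∀ {x y} → Follows y x → ¬ IsSquareN y → Compatible x y
  follows⇒compatible {x} {y} (y≡1 , U , V , y≡N) y-nonsquare = record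
    { coprime = λ (d∣x , d∣y) → ℕ∣.∣1⇒≡1 (prime-free d∣x d∣y)
    ; norm    = U , V , 1ℤ , (λ ()) , y*1 (+ y) U (+ x) V y≡N
    ; norm′   = U , 1ℤ , V , V≢0 , swap-norm (+ y) U (+ x) V y≡N
    }
    where
    prime-free : ∀ {d} → d ∣ x → d ∣ y → d ∣ 1
    prime-free {d} d∣x d∣y = ℤ∣.∣⇒∣ᵤ (≡.subst (+ d ℤ∣.∣_) (solve-∀′ (+ y))
      (ℤ∣.∣m∣n⇒∣m-n {m = + y} (ℤ∣.∣ᵤ⇒∣ d∣y) (ℤ∣.∣-trans (ℤ∣.∣ᵤ⇒∣ d∣x) (divides-difference y≡1))))
      where
      solve-∀′ : ∀ y → y ℤ.- (y ℤ.- 1ℤ) ≡ 1ℤ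
      solve-∀′ = solve-∀
    V≢0 : V ≢ 0ℤ
    V≢0 refl = y-nonsquare (ℤ.∣ U ∣ , ℤₚ.+-injective (≡.sym (≡.trans y≡N (≡.trans (U²-0 U (+ x)) (i*i≡+∣i∣² U)))))

  private
    rescale : ∀ U V W s t x′ y′ → (t ℤ.* t ℤ.* y′) ℤ.* (W ℤ.* W) ≡ U ℤ.* U ℤ.- (s ℤ.* s ℤ.* x′) ℤ.* (V ℤ.* V) →
              y′ ℤ.* ((t ℤ.* W) ℤ.* (t ℤ.* W)) ≡ U ℤ.* U ℤ.- x′ ℤ.* ((s ℤ.* V) ℤ.* (s ℤ.* V))
    rescale U V W s t x′ y′ eq = ≡.trans (lhs t y′ W) (≡.trans eq (rhs U s x′ V))
      where
      lhs : ∀ t y′ W → y′ ℤ.* ((t ℤ.* W) ℤ.* (t ℤ.* W)) ≡ (t ℤ.* t ℤ.* y′) ℤ.* (W ℤ.* W)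
      lhs = solve-∀
      rhs : ∀ U s x′ V → U ℤ.* U ℤ.- (s ℤ.* s ℤ.* x′) ℤ.* (V ℤ.* V) ≡ U ℤ.* U ℤ.- x′ ℤ.* ((s ℤ.* V) ℤ.* (s ℤ.* V))
      rhs = solve-∀

    +-square : ∀ t a → + (t ℕ.* t ℕ.* a) ≡ + t ℤ.* + t ℤ.* + a
    +-square t a = ≡.trans (ℤₚ.pos-* (t ℕ.* t) a) (cong (ℤ._* + a) (ℤₚ.pos-* t t))

    *≢0 : ∀ t W → t ≢ 0 → W ≢ 0ℤ → + t ℤ.* W ≢ 0ℤ
    *≢0 t W t≢0 W≢0 tW≡0 = Sum.[ t≢0 , W≢0 ∘ ℤₚ.∣i∣≡0⇒i≡0 ]
      (ℕₚ.m*n≡0⇒m≡0∨n≡0 t (≡.trans (≡.sym (ℤₚ.abs-* (+ t) W)) (cong ℤ.∣_∣ tW≡0)))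

  isRationalNorm-rescale : ∀ {x y s t x′ y′} → x ≡ s ℕ.* s ℕ.* x′ → y ≡ t ℕ.* t ℕ.* y′ → t ≢ 0 →
                           IsRationalNorm x y → IsRationalNorm x′ y′
  isRationalNorm-rescale {s = s} {t} {x′} {y′} refl refl t≢0 (U , V , W , W≢0 , eq) =
    U , + s ℤ.* V , + t ℤ.* W , *≢0 t W t≢0 W≢0 ,
    rescale U V W (+ s) (+ t) (+ x′) (+ y′) (≡.subst₂ (λ X Y → Y ℤ.* (W ℤ.* W) ≡ U ℤ.* U ℤ.- X ℤ.* (V ℤ.* V))
      (+-square s x′) (+-square t y′) eq)

  compatible-rescale : ∀ {x y s t x′ y′} → x ≡ s ℕ.* s ℕ.* x′ → y ≡ t ℕ.* t ℕ.* y′ → s ≢ 0 → t ≢ 0 →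
                       Compatible x y → Compatible x′ y′
  compatible-rescale {s = s} {t} {x′} {y′} x≡ y≡ s≢0 t≢0 c = record
    { coprime = λ (d∣x′ , d∣y′) → coprime (ℕ∣.∣-trans d∣x′ (divides (s ℕ.* s) x≡) , ℕ∣.∣-trans d∣y′ (divides (t ℕ.* t) y≡))
    ; norm    = isRationalNorm-rescale {s = s} {t} {x′} {y′} x≡ y≡ t≢0 norm
    ; norm′   = isRationalNorm-rescale {s = t} {s} {y′} {x′} y≡ x≡ s≢0 norm′
    }
    where
      open Compatible c

  allPairs-lookup : ∀ {R : ℕ → ℕ → Set} → Symmetric R → ∀ {xs} → AllPairs R xs →
                    ∀ i j → i ≢ j → R (lookup xs i) (lookup xs j)
  allPairs-lookup sym (Rx ∷ _)   zero    zero    i≢j = contradiction refl i≢j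
  allPairs-lookup sym (Rx ∷ _)   zero    (suc j) _   = All.lookup Rx (∈-lookup j)
  allPairs-lookup sym (Rx ∷ _)   (suc i) zero    _   = sym (All.lookup Rx (∈-lookup i))
  allPairs-lookup sym (_ ∷ Rxs) (suc i) (suc j) i≢j = allPairs-lookup sym Rxs i j (i≢j ∘ cong suc)

  record MutualNormFamily (N : ℕ) : Set where
    field
      a          : Fin N → ℕ
      squarefree : ∀ i → SquarefreeN (a i)
      nontrivial : ∀ i → 2 ≤ a i
      compatible : ∀ i j → i ≢ j → Compatible (a i) (a j)

  opaque
    mutualNormFamily : ∀ N → MutualNormFamily N
    mutualNormFamily N with followingFamily N
    ... | bs , refl , follows , nonsquare = record
      { a          = a
      ; squarefree = λ i → proj₂ (proj₂ (proj₂ (decomposition i)))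
      ; nontrivial = nontrivial
      ; compatible = λ i j i≢j → compatible-rescale (b≡ i) (b≡ j) (t≢0 i) (t≢0 j)
                                   (allPairs-lookup compatible-sym (compatibles follows nonsquare) i j i≢j)
      }
      where
      compatibles : ∀ {bs} → AllPairs Follows bs → All (λ b → ¬ IsSquareN b) bs → AllPairs Compatible bs
      compatibles []         []           = []
      compatibles (f ∷ fs) (ns ∷ nss) = All.map (λ fy → compatible-sym (follows⇒compatible fy ns)) f ∷ compatibles fs nss
      b : Fin (length bs) → ℕ
      b = lookup bs
      0<b : ∀ i → 0 < b i
      0<b i = ℕₚ.n≢0⇒n>0 (λ b≡0 → All.lookup nonsquare (∈-lookup i) (0 , ≡.sym b≡0))
      decomposition : ∀ i → Σ[ t ∈ ℕ ] Σ[ a ∈ ℕ ] b i ≡ t ℕ.* t ℕ.* a × SquarefreeN a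
      decomposition i = squarefree-decomposition (b i) (0<b i)
      t a : Fin (length bs) → ℕ
      t i = proj₁ (decomposition i)
      a i = proj₁ (proj₂ (decomposition i))
      b≡ : ∀ i → b i ≡ t i ℕ.* t i ℕ.* a i
      b≡ i = proj₁ (proj₂ (proj₂ (decomposition i)))
      t≢0 : ∀ i → t i ≢ 0
      t≢0 i t≡0 = ℕₚ.<⇒≢ (0<b i) (≡.sym (≡.trans (b≡ i) (cong (λ s → s ℕ.* s ℕ.* a i) t≡0)))
      nontrivial : ∀ i → 2 ≤ a i
      nontrivial i with a i | b≡ i
      ... | 0           | b≡0   = contradiction (≡.trans b≡0 (ℕₚ.*-zeroʳ (t i ℕ.* t i))) (ℕₚ.<⇒≢ (0<b i) ∘ ≡.sym)
      ... | 1           | b≡t²  = contradiction (t i , ≡.sym (≡.trans b≡t² (ℕₚ.*-identityʳ _))) (All.lookup nonsquare (∈-lookup i))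
      ... | suc (suc _) | _     = s≤s (s≤s z≤n)

module ShaRank where
  open Squarefree using (¬squarefree[0]; squarefree⇒nonZero; squarefree⇒¬square; squarefree-*; squarefree-∣-square)
  open Family using (IsRationalNorm; Compatible; MutualNormFamily)
  open import Data.Bool.Base using (Bool; true; false)
  open import Data.Fin.Base using (Fin; zero; suc; _↑ʳ_)
  import Data.Fin.Properties as Finₚ
  open import Data.Integer.Base as ℤ using (+_; -[1+_]; 0ℤ; 1ℤ)
  open import Data.Integer.DivMod using (_%ℕ_)
  import Data.Integer.Properties as ℤₚ
  open import Data.Integer.Tactic.RingSolver using (solve-∀)
  open import Data.Nat.Base as ℕ using (zero; suc; _≤_; _<_; z≤n; s≤s)
  open import Data.Nat.Coprimality using (Coprime; coprime-divisor)
  import Data.Nat.DivMod as ℕDM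
  open import Data.Nat.Divisibility as ℕ∣ using (_∣_; divides)
  import Data.Nat.Properties as ℕₚ
  open import Algebra.Properties.CommutativeSemigroup ℕₚ.*-commutativeSemigroup using (x∙yz≈y∙xz)
  open import Data.Nat.Tactic.RingSolver using () renaming (solve-∀ to ℕ-solve-∀)
  open import Data.Product.Base using (Σ-syntax; _,_; proj₁)
  open import Data.Rational.Base as ℚ using (ℚ; 1/_)
  import Data.Rational.Properties as ℚₚ
  open import Data.Rational.Solver using (module +-*-Solver)
  import Data.Rational.Unnormalised.Base as ℚᵘ
  import Data.Rational.Unnormalised.Properties as ℚᵘₚ
  open import Data.Sum.Base as Sum using (_⊎_; inj₁; inj₂)
  open import Function.Base using (_∘_; const)
  open import Relation.Binary.PropositionalEquality as ≡ using (_≡_; _≢_; refl; cong; cong₂)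
  open import Relation.Nullary.Negation using (¬_; contradiction)

  coprime-* : ∀ {x y z} → Coprime x y → Coprime x z → Coprime x (y ℕ.* z)
  coprime-* x⊥y x⊥z (d∣x , d∣yz) = x⊥z (d∣x , coprime-divisor (λ (e∣d , e∣y) → x⊥y (ℕ∣.∣-trans e∣d d∣x , e∣y)) d∣yz)

  coprime-1 : ∀ {x} → Coprime x 1
  coprime-1 (_ , d∣1) = ℕ∣.∣1⇒≡1 d∣1

  squarefree[1] : SquarefreeN 1
  squarefree[1] p p²∣1 = ℕₚ.m*n≡1⇒n≡1 p p (ℕ∣.∣1⇒≡1 p²∣1)

  except : ∀ {n} → Fin n → Fin n → Bool
  except zero    zero    = false
  except zero    (suc _) = true
  except (suc _) zero    = true
  except (suc k) (suc j) = except k j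

  except-≢ : ∀ {n} (k j : Fin n) → except k j ≡ true → j ≢ k
  except-≢ zero    (suc j) _  ()
  except-≢ (suc k) zero    _  ()
  except-≢ (suc k) (suc j) e  refl = except-≢ k j e refl

  prodSub-except : ∀ n (a : Fin n → ℕ) k → prodSub n a (const true) ≡ a k ℕ.* prodSub n a (except k)
  prodSub-except (suc n) a zero    = refl
  prodSub-except (suc n) a (suc k) = ≡.trans (cong (a zero ℕ.*_) (prodSub-except n (a ∘ suc) k))
                                               (x∙yz≈y∙xz (a zero) (a (suc k)) _)

  module _ where
    private
      tail-≢ : ∀ {n} {P : Fin (suc n) → Fin (suc n) → Set} → (∀ i j → i ≢ j → P i j) →
               ∀ (i j : Fin n) → i ≢ j → P (suc i) (suc j)
      tail-≢ h i j i≢j = h (suc i) (suc j) (i≢j ∘ Finₚ.suc-injective)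

    coprime-prodSub : ∀ n (a : Fin n → ℕ) S {x} → (∀ j → Coprime x (a j)) → Coprime x (prodSub n a S)
    coprime-prodSub zero    a S x⊥a = coprime-1
    coprime-prodSub (suc n) a S x⊥a with S zero
    ... | true  = coprime-* (x⊥a zero) (coprime-prodSub n (a ∘ suc) (S ∘ suc) (x⊥a ∘ suc))
    ... | false = coprime-prodSub n (a ∘ suc) (S ∘ suc) (x⊥a ∘ suc)

    prodSub-squarefree : ∀ n (a : Fin n → ℕ) S → (∀ i → SquarefreeN (a i)) →
                         (∀ i j → i ≢ j → Coprime (a i) (a j)) → SquarefreeN (prodSub n a S)
    prodSub-squarefree zero    a S sf a⊥a = squarefree[1]
    prodSub-squarefree (suc n) a S sf a⊥a with S zero
    ... | true  = squarefree-* (sf zero) (prodSub-squarefree n (a ∘ suc) (S ∘ suc) (sf ∘ suc) (tail-≢ a⊥a))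
                    (coprime-prodSub n (a ∘ suc) (S ∘ suc) (λ j → a⊥a zero (suc j) λ ()))
    ... | false = prodSub-squarefree n (a ∘ suc) (S ∘ suc) (sf ∘ suc) (tail-≢ a⊥a)

  prodSub-positive : ∀ n (a : Fin n → ℕ) S → (∀ i → 1 ≤ a i) → 1 ≤ prodSub n a S
  prodSub-positive zero    a S a≥1 = ℕₚ.≤-refl
  prodSub-positive (suc n) a S a≥1 with S zero
  ... | true  = ℕₚ.*-mono-≤ (a≥1 zero) (prodSub-positive n (a ∘ suc) (S ∘ suc) (a≥1 ∘ suc))
  ... | false = prodSub-positive n (a ∘ suc) (S ∘ suc) (a≥1 ∘ suc)

  prodSub-nontrivial : ∀ n (a : Fin n → ℕ) S → (∀ i → 2 ≤ a i) → Σ[ i ∈ Fin n ] S i ≡ true → 2 ≤ prodSub n a S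
  prodSub-nontrivial (suc n) a S a≥2 (i , Sᵢ) with S zero in S₀
  ... | true  = ℕₚ.*-mono-≤ (a≥2 zero) (prodSub-positive n (a ∘ suc) (S ∘ suc) (ℕₚ.<⇒≤ ∘ a≥2 ∘ suc))
  prodSub-nontrivial (suc n) a S a≥2 (zero  , Sᵢ) | false = contradiction (≡.trans (≡.sym S₀) Sᵢ) λ ()
  prodSub-nontrivial (suc n) a S a≥2 (suc i , Sᵢ) | false = prodSub-nontrivial n (a ∘ suc) (S ∘ suc) (a≥2 ∘ suc) (i , Sᵢ)

  prodSub-≤ : ∀ n (a : Fin n → ℕ) S → (∀ i → 1 ≤ a i) → prodSub n a S ≤ prodSub n a (const true)
  prodSub-≤ zero    a S a≥1 = ℕₚ.≤-refl
  prodSub-≤ (suc n) a S a≥1 with S zero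
  ... | true  = ℕₚ.*-monoʳ-≤ (a zero) (prodSub-≤ n (a ∘ suc) (S ∘ suc) (a≥1 ∘ suc))
  ... | false = ℕₚ.≤-trans (prodSub-≤ n (a ∘ suc) (S ∘ suc) (a≥1 ∘ suc)) (ℕₚ.m≤n*m _ (a zero) {{ℕ.>-nonZero (a≥1 zero)}})

  private
    *≢0 : ∀ {A B} → A ≢ 0ℤ → B ≢ 0ℤ → A ℤ.* B ≢ 0ℤ
    *≢0 {A} {B} A≢0 B≢0 AB≡0 = Sum.[ A≢0 ∘ ℤₚ.∣i∣≡0⇒i≡0 , B≢0 ∘ ℤₚ.∣i∣≡0⇒i≡0 ]
      (ℕₚ.m*n≡0⇒m≡0∨n≡0 ℤ.∣ A ∣ (≡.trans (≡.sym (ℤₚ.abs-* A B)) (cong ℤ.∣_∣ AB≡0)))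

    one-norm : ∀ X → + 1 ℤ.* (1ℤ ℤ.* 1ℤ) ≡ 1ℤ ℤ.* 1ℤ ℤ.- X ℤ.* (0ℤ ℤ.* 0ℤ)
    one-norm = solve-∀

    split-weights : ∀ Y Z W₁ W₂ → (Y ℤ.* Z) ℤ.* ((W₁ ℤ.* W₂) ℤ.* (W₁ ℤ.* W₂)) ≡ (Y ℤ.* (W₁ ℤ.* W₁)) ℤ.* (Z ℤ.* (W₂ ℤ.* W₂))
    split-weights = solve-∀

    brahmagupta : ∀ U₁ U₂ V₁ V₂ X →
      (U₁ ℤ.* U₁ ℤ.- X ℤ.* (V₁ ℤ.* V₁)) ℤ.* (U₂ ℤ.* U₂ ℤ.- X ℤ.* (V₂ ℤ.* V₂)) ≡
      (U₁ ℤ.* U₂ ℤ.+ X ℤ.* (V₁ ℤ.* V₂)) ℤ.* (U₁ ℤ.* U₂ ℤ.+ X ℤ.* (V₁ ℤ.* V₂)) ℤ.-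
      X ℤ.* ((U₁ ℤ.* V₂ ℤ.+ U₂ ℤ.* V₁) ℤ.* (U₁ ℤ.* V₂ ℤ.+ U₂ ℤ.* V₁))
    brahmagupta = solve-∀

  isRationalNorm-1 : ∀ x → IsRationalNorm x 1
  isRationalNorm-1 x = 1ℤ , 0ℤ , 1ℤ , (λ ()) , one-norm (+ x)

  isRationalNorm-* : ∀ {x y z} → IsRationalNorm x y → IsRationalNorm x z → IsRationalNorm x (y ℕ.* z)
  isRationalNorm-* {x} {y} {z} (U₁ , V₁ , W₁ , W₁≢0 , eq₁) (U₂ , V₂ , W₂ , W₂≢0 , eq₂) =
    U₁ ℤ.* U₂ ℤ.+ + x ℤ.* (V₁ ℤ.* V₂) , U₁ ℤ.* V₂ ℤ.+ U₂ ℤ.* V₁ , W₁ ℤ.* W₂ , *≢0 W₁≢0 W₂≢0 ,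
    ≡.trans (cong (ℤ._* ((W₁ ℤ.* W₂) ℤ.* (W₁ ℤ.* W₂))) (ℤₚ.pos-* y z))
      (≡.trans (split-weights (+ y) (+ z) W₁ W₂) (≡.trans (cong₂ ℤ._*_ eq₁ eq₂) (brahmagupta U₁ U₂ V₁ V₂ (+ x))))

  isRationalNorm-prodSub : ∀ n (a : Fin n → ℕ) S {x} → (∀ j → S j ≡ true → IsRationalNorm x (a j)) →
                           IsRationalNorm x (prodSub n a S)
  isRationalNorm-prodSub zero    a S {x} _ = isRationalNorm-1 x
  isRationalNorm-prodSub (suc n) a S {x} h with S zero in S₀
  ... | true  = isRationalNorm-* {x} {a zero} (h zero S₀) (isRationalNorm-prodSub n (a ∘ suc) (S ∘ suc) {x} (h ∘ suc))
  ... | false = isRationalNorm-prodSub n (a ∘ suc) (S ∘ suc) {x} (h ∘ suc)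

  private
    toℚᵘ-⟦⟧ : ∀ i → ℚ.toℚᵘ ⟦ i ⟧ ℚᵘ.≃ ℚᵘ.mkℚᵘ i 0
    toℚᵘ-⟦⟧ i = ℚₚ.toℚᵘ-fromℚᵘ (ℚᵘ.mkℚᵘ i 0)

    ⟦⟧-homo : ∀ {f : ℤ → ℤ → ℤ} {g : ℚ → ℚ → ℚ} {h : ℚᵘ.ℚᵘ → ℚᵘ.ℚᵘ → ℚᵘ.ℚᵘ} →
              (∀ p q → ℚ.toℚᵘ (g p q) ℚᵘ.≃ h (ℚ.toℚᵘ p) (ℚ.toℚᵘ q)) →
              (∀ {p p′ q q′} → p ℚᵘ.≃ p′ → q ℚᵘ.≃ q′ → h p q ℚᵘ.≃ h p′ q′) →
              (∀ i j → h (ℚᵘ.mkℚᵘ i 0) (ℚᵘ.mkℚᵘ j 0) ℚᵘ.≃ ℚᵘ.mkℚᵘ (f i j) 0) →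
              ∀ i j → ⟦ f i j ⟧ ≡ g ⟦ i ⟧ ⟦ j ⟧
    ⟦⟧-homo homo cong h-mk i j = ℚₚ.toℚᵘ-injective (ℚᵘₚ.≃-trans (toℚᵘ-⟦⟧ _) (ℚᵘₚ.≃-sym
      (ℚᵘₚ.≃-trans (homo ⟦ i ⟧ ⟦ j ⟧) (ℚᵘₚ.≃-trans (cong (toℚᵘ-⟦⟧ i) (toℚᵘ-⟦⟧ j)) (h-mk i j)))))

    ⟦⟧-homo-* : ∀ i j → ⟦ i ℤ.* j ⟧ ≡ ⟦ i ⟧ ℚ.* ⟦ j ⟧
    ⟦⟧-homo-* = ⟦⟧-homo {ℤ._*_} {ℚ._*_} {ℚᵘ._*_} ℚₚ.toℚᵘ-homo-* ℚᵘₚ.*-cong (λ _ _ → ℚᵘₚ.≃-refl)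

    ⟦⟧-homo-- : ∀ i j → ⟦ i ℤ.- j ⟧ ≡ ⟦ i ⟧ ℚ.- ⟦ j ⟧
    ⟦⟧-homo-- = ⟦⟧-homo {ℤ._-_} {ℚ._-_} {ℚᵘ._-_}
      (λ p q → ℚᵘₚ.≃-trans (ℚₚ.toℚᵘ-homo-+ p (ℚ.- q)) (ℚᵘₚ.+-cong (ℚᵘₚ.≃-refl {ℚ.toℚᵘ p}) (ℚₚ.toℚᵘ-homo‿- q)))
      (λ p≃p′ q≃q′ → ℚᵘₚ.+-cong p≃p′ (ℚᵘₚ.-‿cong q≃q′))
      (λ i j → ℚᵘ.*≡* (solve-∀′ i j))
      where
      solve-∀′ : ∀ i j → (i ℤ.* 1ℤ ℤ.+ ℤ.- j ℤ.* 1ℤ) ℤ.* 1ℤ ≡ (i ℤ.- j) ℤ.* (1ℤ ℤ.* 1ℤ)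
      solve-∀′ = solve-∀

    ⟦⟧-homo-*² : ∀ i j → ⟦ i ℤ.* (j ℤ.* j) ⟧ ≡ ⟦ i ⟧ ℚ.* (⟦ j ⟧ ℚ.* ⟦ j ⟧)
    ⟦⟧-homo-*² i j = ≡.trans (⟦⟧-homo-* i (j ℤ.* j)) (cong (⟦ i ⟧ ℚ.*_) (⟦⟧-homo-* j j))

    ⟦⟧≡0⇒≡0 : ∀ i → ⟦ i ⟧ ≡ ℚ.0ℚ → i ≡ 0ℤ
    ⟦⟧≡0⇒≡0 i ⟦i⟧≡0 with ℚᵘₚ.≃-trans (ℚᵘₚ.≃-sym (toℚᵘ-⟦⟧ i)) (ℚₚ.toℚᵘ-cong ⟦i⟧≡0)
    ... | ℚᵘ.*≡* i*1≡0*1 = ≡.trans (≡.sym (ℤₚ.*-identityʳ i)) i*1≡0*1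

  rational-point : ∀ x b A C U → U ≢ 0ℤ → x ℤ.* (A ℤ.* A) ℤ.- b ℤ.* (C ℤ.* C) ≡ + 4 ℤ.* (U ℤ.* U) →
                   Σ[ r ∈ ℚ ] Σ[ s ∈ ℚ ] ⟦ x ⟧ ℚ.* r ℚ.* r ℚ.- ⟦ b ⟧ ℚ.* s ℚ.* s ≡ ⟦ + 4 ⟧
  rational-point x b A C U U≢0 eq = ⟦ A ⟧ ℚ.* u⁻¹ , ⟦ C ⟧ ℚ.* u⁻¹ , (begin
    ⟦ x ⟧ ℚ.* (⟦ A ⟧ ℚ.* u⁻¹) ℚ.* (⟦ A ⟧ ℚ.* u⁻¹) ℚ.- ⟦ b ⟧ ℚ.* (⟦ C ⟧ ℚ.* u⁻¹) ℚ.* (⟦ C ⟧ ℚ.* u⁻¹)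
      ≡⟨ solve 6 (λ x A b C u u⁻¹ → x :* (A :* u⁻¹) :* (A :* u⁻¹) :- b :* (C :* u⁻¹) :* (C :* u⁻¹)
                                     := (x :* (A :* A) :- b :* (C :* C)) :* (u⁻¹ :* u⁻¹)) refl
                   ⟦ x ⟧ ⟦ A ⟧ ⟦ b ⟧ ⟦ C ⟧ ⟦ U ⟧ u⁻¹ ⟩
    (⟦ x ⟧ ℚ.* (⟦ A ⟧ ℚ.* ⟦ A ⟧) ℚ.- ⟦ b ⟧ ℚ.* (⟦ C ⟧ ℚ.* ⟦ C ⟧)) ℚ.* (u⁻¹ ℚ.* u⁻¹)
      ≡⟨ cong (ℚ._* (u⁻¹ ℚ.* u⁻¹)) ⟦eq⟧ ⟩
    ⟦ + 4 ⟧ ℚ.* (⟦ U ⟧ ℚ.* ⟦ U ⟧) ℚ.* (u⁻¹ ℚ.* u⁻¹)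
      ≡⟨ solve 3 (λ f u u⁻¹ → f :* (u :* u) :* (u⁻¹ :* u⁻¹) := f :* ((u :* u⁻¹) :* (u :* u⁻¹))) refl ⟦ + 4 ⟧ ⟦ U ⟧ u⁻¹ ⟩
    ⟦ + 4 ⟧ ℚ.* ((⟦ U ⟧ ℚ.* u⁻¹) ℚ.* (⟦ U ⟧ ℚ.* u⁻¹))
      ≡⟨ cong (λ t → ⟦ + 4 ⟧ ℚ.* (t ℚ.* t)) (ℚₚ.*-inverseʳ ⟦ U ⟧) ⟩
    ⟦ + 4 ⟧ ℚ.* (ℚ.1ℚ ℚ.* ℚ.1ℚ)
      ≡⟨ ℚₚ.*-identityʳ ⟦ + 4 ⟧ ⟩
    ⟦ + 4 ⟧ ∎)
    where
    open ≡.≡-Reasoning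
    open +-*-Solver using (solve; _:=_; _:-_; _:*_)
    instance
      ⟦U⟧≢0 : ℚ.NonZero ⟦ U ⟧
      ⟦U⟧≢0 = ℚ.≢-nonZero (U≢0 ∘ ⟦⟧≡0⇒≡0 U)
    u⁻¹ = 1/ ⟦ U ⟧
    ⟦eq⟧ : ⟦ x ⟧ ℚ.* (⟦ A ⟧ ℚ.* ⟦ A ⟧) ℚ.- ⟦ b ⟧ ℚ.* (⟦ C ⟧ ℚ.* ⟦ C ⟧) ≡ ⟦ + 4 ⟧ ℚ.* (⟦ U ⟧ ℚ.* ⟦ U ⟧)
    ⟦eq⟧ = begin
      ⟦ x ⟧ ℚ.* (⟦ A ⟧ ℚ.* ⟦ A ⟧) ℚ.- ⟦ b ⟧ ℚ.* (⟦ C ⟧ ℚ.* ⟦ C ⟧)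
        ≡⟨ cong₂ ℚ._-_ (⟦⟧-homo-*² x A) (⟦⟧-homo-*² b C) ⟨
      ⟦ x ℤ.* (A ℤ.* A) ⟧ ℚ.- ⟦ b ℤ.* (C ℤ.* C) ⟧
        ≡⟨ ⟦⟧-homo-- (x ℤ.* (A ℤ.* A)) (b ℤ.* (C ℤ.* C)) ⟨
      ⟦ x ℤ.* (A ℤ.* A) ℤ.- b ℤ.* (C ℤ.* C) ⟧
        ≡⟨ cong ⟦_⟧ eq ⟩
      ⟦ + 4 ℤ.* (U ℤ.* U) ⟧
        ≡⟨ ⟦⟧-homo-*² (+ 4) U ⟩
      ⟦ + 4 ⟧ ℚ.* (⟦ U ⟧ ℚ.* ⟦ U ⟧) ∎

  private
    -[1+]%4 : ∀ k r → suc k ℕ.% 4 ≡ suc r → -[1+ k ] %ℕ 4 ≡ 4 ℕ.∸ suc r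
    -[1+]%4 k r eq rewrite eq = refl

  record NegativeDiscriminant (m : ℕ) : Set where
    field
      f g    : ℕ
      fg≡2   : f ℕ.* g ≡ 2
      isDisc : IsDisc (ℤ.- + (f ℕ.* f ℕ.* m))

    m≤f²m : m ≤ f ℕ.* f ℕ.* m
    m≤f²m = ℕₚ.m≤n*m m (f ℕ.* f) {{ℕₚ.m*n≢0 f f {{f≢0}} {{f≢0}}}}
      where
      f≢0 : ℕ.NonZero f
      f≢0 = ℕ.≢-nonZero λ f≡0 → contradiction (≡.trans (cong (ℕ._* g) (≡.sym f≡0)) fg≡2) λ ()

  discriminant : ∀ m → SquarefreeN m → NegativeDiscriminant m
  discriminant zero    sf = contradiction sf ¬squarefree[0]
  discriminant (suc k) sf with suc k ℕ.% 4 in m%4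
  ... | 0 = contradiction (sf 2 (ℕ∣.m%n≡0⇒n∣m (suc k) 4 m%4)) λ ()
  ... | 1 = record { f = 2 ; g = 1 ; fg≡2 = refl ; isDisc = -[1+ k ] , sf , inj₂ (inj₂ (-[1+]%4 k 0 m%4) , refl) }
  ... | 2 = record { f = 2 ; g = 1 ; fg≡2 = refl ; isDisc = -[1+ k ] , sf , inj₂ (inj₁ (-[1+]%4 k 1 m%4) , refl) }
  ... | 3 = record { f = 1 ; g = 2 ; fg≡2 = refl
                  ; isDisc = -[1+ k ] , sf , inj₁ (-[1+]%4 k 2 m%4 , (λ ()) , cong (λ t → ℤ.- + t) (ℕₚ.+-identityʳ (suc k))) }
  ... | suc (suc (suc (suc _))) = contradiction (≡.subst (_< 4) m%4 (ℕDM.m%n<n (suc k) 4)) λ { (s≤s (s≤s (s≤s (s≤s ())))) }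

  private
    i*i≡+∣i∣² : ∀ i → i ℤ.* i ≡ + (ℤ.∣ i ∣ ℕ.* ℤ.∣ i ∣)
    i*i≡+∣i∣² (+ n)    = ≡.sym (ℤₚ.pos-* n n)
    i*i≡+∣i∣² -[1+ n ] = refl

    conic-rescaled : ∀ x y V W F G → F ℤ.* G ≡ + 2 →
      x ℤ.* ((+ 2 ℤ.* V) ℤ.* (+ 2 ℤ.* V)) ℤ.- ℤ.- (F ℤ.* F ℤ.* y) ℤ.* ((G ℤ.* W) ℤ.* (G ℤ.* W)) ≡
      + 4 ℤ.* (x ℤ.* (V ℤ.* V) ℤ.+ y ℤ.* (W ℤ.* W))
    conic-rescaled x y V W F G FG≡2 = ≡.trans (expand x y V W F G)
      (≡.trans (cong (λ t → + 4 ℤ.* (x ℤ.* (V ℤ.* V)) ℤ.+ t ℤ.* t ℤ.* (y ℤ.* (W ℤ.* W))) FG≡2) (collect x y V W))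
      where
      expand : ∀ x y V W F G → x ℤ.* ((+ 2 ℤ.* V) ℤ.* (+ 2 ℤ.* V)) ℤ.- ℤ.- (F ℤ.* F ℤ.* y) ℤ.* ((G ℤ.* W) ℤ.* (G ℤ.* W)) ≡
               + 4 ℤ.* (x ℤ.* (V ℤ.* V)) ℤ.+ (F ℤ.* G) ℤ.* (F ℤ.* G) ℤ.* (y ℤ.* (W ℤ.* W))
      expand = solve-∀
      collect : ∀ x y V W → + 4 ℤ.* (x ℤ.* (V ℤ.* V)) ℤ.+ + 2 ℤ.* + 2 ℤ.* (y ℤ.* (W ℤ.* W)) ≡
                + 4 ℤ.* (x ℤ.* (V ℤ.* V) ℤ.+ y ℤ.* (W ℤ.* W))
      collect = solve-∀

    ℕ-regroup : ∀ f x y → f ℕ.* f ℕ.* (x ℕ.* y) ≡ x ℕ.* (f ℕ.* f ℕ.* y)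
    ℕ-regroup = ℕ-solve-∀

    norm-sum : ∀ x y U V W → y ℤ.* (W ℤ.* W) ≡ U ℤ.* U ℤ.- x ℤ.* (V ℤ.* V) → x ℤ.* (V ℤ.* V) ℤ.+ y ℤ.* (W ℤ.* W) ≡ U ℤ.* U
    norm-sum x y U V W eq = ≡.trans (cong (λ t → x ℤ.* (V ℤ.* V) ℤ.+ t) eq) (cancel x U V)
      where
      cancel : ∀ x U V → x ℤ.* (V ℤ.* V) ℤ.+ (U ℤ.* U ℤ.- x ℤ.* (V ℤ.* V)) ≡ U ℤ.* U
      cancel = solve-∀

  norm-U≢0 : ∀ {x y U V W} → 1 ≤ y → W ≢ 0ℤ → + x ℤ.* (V ℤ.* V) ℤ.+ + y ℤ.* (W ℤ.* W) ≡ U ℤ.* U → U ≢ 0ℤ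
  norm-U≢0 {x} {y} {U} {V} {W} 1≤y W≢0 sum≡U² refl = W≢0 (ℤₚ.∣i∣≡0⇒i≡0 ∣W∣≡0)
    where
    sum≡0 : x ℕ.* (ℤ.∣ V ∣ ℕ.* ℤ.∣ V ∣) ℕ.+ y ℕ.* (ℤ.∣ W ∣ ℕ.* ℤ.∣ W ∣) ≡ 0
    sum≡0 = ℤₚ.+-injective (≡.trans (ℤₚ.pos-+ (x ℕ.* (ℤ.∣ V ∣ ℕ.* ℤ.∣ V ∣)) (y ℕ.* (ℤ.∣ W ∣ ℕ.* ℤ.∣ W ∣))) (≡.trans (cong₂ ℤ._+_
      (≡.trans (ℤₚ.pos-* x _) (cong (+ x ℤ.*_) (≡.sym (i*i≡+∣i∣² V))))
      (≡.trans (ℤₚ.pos-* y _) (cong (+ y ℤ.*_) (≡.sym (i*i≡+∣i∣² W))))) sum≡U²))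
    ∣W∣≡0 : ℤ.∣ W ∣ ≡ 0
    ∣W∣≡0 with ℕₚ.m*n≡0⇒m≡0∨n≡0 y (ℕₚ.m+n≡0⇒n≡0 (x ℕ.* _) sum≡0)
    ... | inj₁ y≡0 = contradiction y≡0 (ℕₚ.<⇒≢ 1≤y ∘ ≡.sym)
    ... | inj₂ ∣W∣²≡0 = Sum.[ (λ e → e) , (λ e → e) ] (ℕₚ.m*n≡0⇒m≡0∨n≡0 ℤ.∣ W ∣ ∣W∣²≡0)

  inSel : ∀ {Δ f g x y} → f ℕ.* g ≡ 2 → Δ ≡ ℤ.- + (f ℕ.* f ℕ.* (x ℕ.* y)) →
          SquarefreeN x → 1 ≤ y → IsRationalNorm x y → InSel Δ x
  inSel {Δ} {f} {g} {x} {y} fg≡2 Δ≡ sf 1≤y (U , V , W , W≢0 , yW²≡N) = sf , b , xb≡Δ ,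
    rational-point (+ x) b (+ 2 ℤ.* V) (+ g ℤ.* W) U (norm-U≢0 {x} {y} {U} {V} {W} 1≤y W≢0 sum≡U²)
      (≡.trans (conic-rescaled (+ x) (+ y) V W (+ f) (+ g) (≡.trans (≡.sym (ℤₚ.pos-* f g)) (cong +_ fg≡2)))
               (cong (+ 4 ℤ.*_) sum≡U²))
    where
    b = ℤ.- (+ f ℤ.* + f ℤ.* + y)
    sum≡U² = norm-sum (+ x) (+ y) U V W yW²≡N
    xb≡Δ : + x ℤ.* b ≡ Δ
    xb≡Δ = ≡.sym (≡.trans Δ≡ (≡.trans (cong ℤ.-_ +f²xy≡) (ℤₚ.neg-distribʳ-* (+ x) _)))
      where
      +f²xy≡ : + (f ℕ.* f ℕ.* (x ℕ.* y)) ≡ + x ℤ.* (+ f ℤ.* + f ℤ.* + y)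
      +f²xy≡ = ≡.trans (cong +_ (ℕ-regroup f x y)) (≡.trans (ℤₚ.pos-* x _)
                 (cong (+ x ℤ.*_) (≡.trans (ℤₚ.pos-* (f ℕ.* f) y) (cong (ℤ._* + y) (ℤₚ.pos-* f f)))))

  small-conic : ∀ {c B} r s → c ℕ.* (r ℕ.* r) ℕ.+ B ℕ.* (s ℕ.* s) ≡ 4 → SquarefreeN c → c ≡ 1 ⊎ B ≤ 4
  small-conic {c} {B} r (suc s) eq _ = inj₂ (ℕₚ.≤-trans (ℕₚ.m≤m*n B (suc s ℕ.* suc s))
                                               (ℕₚ.≤-trans (ℕₚ.m≤n+m _ (c ℕ.* (r ℕ.* r))) (ℕₚ.≤-reflexive eq)))
  small-conic {c} {B} r zero eq sf = inj₁ (on-axis r (≡.trans (≡.sym (ℕₚ.+-identityʳ _))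
                                           (≡.trans (cong (c ℕ.* (r ℕ.* r) ℕ.+_) (≡.sym (ℕₚ.*-zeroʳ B))) eq)))
    where
    on-axis : ∀ r → c ℕ.* (r ℕ.* r) ≡ 4 → c ≡ 1
    on-axis 0 c*0≡4 = contradiction (≡.trans (≡.sym (ℕₚ.*-zeroʳ c)) c*0≡4) λ ()
    on-axis 1 c≡4 with sf 2 (divides 1 (≡.trans (≡.sym (ℕₚ.*-identityʳ c)) c≡4))
    ... | ()
    on-axis 2 4c≡4 = ℕₚ.*-cancelʳ-≡ c 1 4 4c≡4
    on-axis r@(suc (suc (suc _))) c*r²≡4 = contradiction c*r²≡4 (ℕₚ.>⇒≢ (ℕₚ.<-≤-trans (ℕₚ.n<1+n 4)
      (ℕₚ.*-mono-≤ (squarefree⇒nonZero sf) (ℕₚ.≤-trans (ℕₚ.m≤m+n 5 4) (ℕₚ.*-mono-≤ 3≤r 3≤r)))))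
      where
      3≤r : 3 ≤ r
      3≤r = s≤s (s≤s (s≤s z≤n))

  W-small : ∀ {D c} → 0 < D → InW (ℤ.- + D) c → c ≡ 1 ⊎ D ≤ 4 ℕ.* c
  W-small {suc D} {c} _ (sf , + j , cj≡-D , _) = contradiction (≡.trans (ℤₚ.pos-* c j) cj≡-D) λ ()
  W-small {D} {c} 0<D (sf , -[1+ B′ ] , cb≡-D , r , s , point) with small-conic ℤ.∣ r ∣ ℤ.∣ s ∣ point′ sf
    where
    point′ : c ℕ.* (ℤ.∣ r ∣ ℕ.* ℤ.∣ r ∣) ℕ.+ suc B′ ℕ.* (ℤ.∣ s ∣ ℕ.* ℤ.∣ s ∣) ≡ 4
    point′ = ℤₚ.+-injective (≡.trans (ℤₚ.pos-+ (c ℕ.* (ℤ.∣ r ∣ ℕ.* ℤ.∣ r ∣)) (suc B′ ℕ.* (ℤ.∣ s ∣ ℕ.* ℤ.∣ s ∣)))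
      (≡.trans (cong₂ ℤ._+_ (≡.trans (ℤₚ.pos-* c _) (cong (+ c ℤ.*_) (≡.sym (i*i≡+∣i∣² r))))
                            (≡.trans (ℤₚ.pos-* (suc B′) _) (cong (+ suc B′ ℤ.*_) (≡.sym (i*i≡+∣i∣² s)))))
        (≡.trans (regroup (+ c) r s (+ suc B′)) point)))
      where
      regroup : ∀ C r s B → C ℤ.* (r ℤ.* r) ℤ.+ B ℤ.* (s ℤ.* s) ≡ C ℤ.* r ℤ.* r ℤ.- ℤ.- B ℤ.* s ℤ.* s
      regroup = solve-∀
  ... | inj₁ c≡1 = inj₁ c≡1
  ... | inj₂ B≤4 = inj₂ (≡.subst (_≤ 4 ℕ.* c) cB≡D (ℕₚ.≤-trans (ℕₚ.*-monoʳ-≤ c B≤4) (ℕₚ.≤-reflexive (ℕₚ.*-comm c 4))))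
    where
    cB≡D : c ℕ.* suc B′ ≡ D
    cB≡D = ℤₚ.+-injective (≡.trans (ℤₚ.pos-* c (suc B′))
      (ℤₚ.neg-injective (≡.trans (ℤₚ.neg-distribʳ-* (+ c) (+ suc B′)) cb≡-D)))

  squarefree-∣-cofactor : ∀ {c P k} → SquarefreeN c → c ℕ.* P ≡ k ℕ.* k → c ∣ P
  squarefree-∣-cofactor {c} {P} {k} sf cP≡k² with squarefree-∣-square c sf k (divides P (≡.trans (≡.sym cP≡k²) (ℕₚ.*-comm c P)))
  ... | divides k′ refl = divides (k′ ℕ.* k′) (ℕₚ.*-cancelˡ-≡ P (k′ ℕ.* k′ ℕ.* c) c {{ℕ.>-nonZero (squarefree⇒nonZero sf)}}
          (≡.trans cP≡k² (regroup k′ c)))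
    where
    regroup : ∀ k′ c → k′ ℕ.* c ℕ.* (k′ ℕ.* c) ≡ c ℕ.* (k′ ℕ.* k′ ℕ.* c)
    regroup = ℕ-solve-∀

  -- A class c ∈ W₂ with c · P a square would be small, hence divide P; but m is too large for that.
  W-independent : ∀ {D m P c} → m ≤ D → 4 ℕ.* P < m → SquarefreeN P → 2 ≤ P →
                  InW (ℤ.- + D) c → ¬ IsSquareN (c ℕ.* P)
  W-independent {D} {m} {P} {c} m≤D 4P<m sfP 2≤P c∈W (k , k²≡cP) with W-small 0<D c∈W
    where 0<D = ℕₚ.<-≤-trans (ℕₚ.≤-<-trans z≤n 4P<m) m≤D
  ... | inj₁ refl = squarefree⇒¬square sfP 2≤P k (≡.trans k²≡cP (ℕₚ.+-identityʳ P))
  ... | inj₂ D≤4c = ℕₚ.<-irrefl refl (ℕₚ.≤-<-trans m≤4P 4P<m)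
    where
    c≤P : c ≤ P
    c≤P = ℕ∣.∣⇒≤ {{ℕ.>-nonZero (ℕₚ.<-trans (s≤s z≤n) 2≤P)}} (squarefree-∣-cofactor {k = k} (proj₁ c∈W) (≡.sym k²≡cP))
    m≤4P : m ≤ 4 ℕ.* P
    m≤4P = ℕₚ.≤-trans m≤D (ℕₚ.≤-trans D≤4c (ℕₚ.*-monoʳ-≤ 4 c≤P))

  4*P<x*[y*[z*Q]] : ∀ {x y z P Q} → 2 ≤ x → 2 ≤ y → 2 ≤ z → 1 ≤ Q → P ≤ Q → 4 ℕ.* P < x ℕ.* (y ℕ.* (z ℕ.* Q))
  4*P<x*[y*[z*Q]] {Q = Q} 2≤x 2≤y 2≤z 1≤Q P≤Q = ℕₚ.≤-<-trans (ℕₚ.*-monoʳ-≤ 4 P≤Q)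
    (ℕₚ.<-≤-trans (ℕₚ.m<m+n (4 ℕ.* Q) (ℕₚ.<-≤-trans (s≤s z≤n) (ℕₚ.*-monoʳ-≤ 4 1≤Q)))
      (ℕₚ.≤-trans (ℕₚ.≤-reflexive (eight Q)) (ℕₚ.*-mono-≤ 2≤x (ℕₚ.*-mono-≤ 2≤y (ℕₚ.*-monoˡ-≤ Q 2≤z)))))
    where
    eight : ∀ Q → 4 ℕ.* Q ℕ.+ 4 ℕ.* Q ≡ 2 ℕ.* (2 ℕ.* (2 ℕ.* Q))
    eight = ℕ-solve-∀

  module _ {n : ℕ} (F : MutualNormFamily (3 ℕ.+ n)) where
    open MutualNormFamily F

    private
      1≤a : ∀ i → 1 ≤ a i
      1≤a i = ℕₚ.<⇒≤ (nontrivial i)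

      coprime : ∀ i j → i ≢ j → Coprime (a i) (a j)
      coprime i j i≢j = Compatible.coprime (compatible i j i≢j)

    product-squarefree : SquarefreeN (prodSub (3 ℕ.+ n) a (const true))
    product-squarefree = prodSub-squarefree (3 ℕ.+ n) a (const true) squarefree coprime

    module _ (disc : NegativeDiscriminant (prodSub (3 ℕ.+ n) a (const true))) where
      open NegativeDiscriminant disc
      private
        m = prodSub (3 ℕ.+ n) a (const true)
        D = f ℕ.* f ℕ.* m

      family-inSel : ∀ k → InSel (ℤ.- + D) (a k)
      family-inSel k = inSel {ℤ.- + D} {f} {g} {a k} {prodSub (3 ℕ.+ n) a (except k)} fg≡2
        (cong (λ t → ℤ.- + (f ℕ.* f ℕ.* t)) (prodSub-except (3 ℕ.+ n) a k)) (squarefree k)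
        (prodSub-positive (3 ℕ.+ n) a (except k) 1≤a)
        (isRationalNorm-prodSub (3 ℕ.+ n) a (except k) {a k}
          λ j kj → Compatible.norm (compatible k j (except-≢ k j kj ∘ ≡.sym)))

      family-independent : IndepModW (ℤ.- + D) n (a ∘ (3 ↑ʳ_))
      family-independent S nonempty (c , c∈W , cP-square) = W-independent {D} {m} {P} {c} m≤f²m
        (4*P<x*[y*[z*Q]] {a zero} {a (suc zero)} {a (suc (suc zero))} {P} {prodSub n a′ (const true)}
          (nontrivial zero) (nontrivial (suc zero)) (nontrivial (suc (suc zero)))
          (prodSub-positive n a′ (const true) (1≤a ∘ (3 ↑ʳ_))) (prodSub-≤ n a′ S (1≤a ∘ (3 ↑ʳ_))))
        (prodSub-squarefree n a′ S (squarefree ∘ (3 ↑ʳ_))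
          (λ i j i≢j → coprime _ _ (i≢j ∘ Finₚ.suc-injective ∘ Finₚ.suc-injective ∘ Finₚ.suc-injective)))
        (prodSub-nontrivial n a′ S (nontrivial ∘ (3 ↑ʳ_)) nonempty) c∈W cP-square
        where
        a′ = a ∘ (3 ↑ʳ_)
        P = prodSub n a′ S

open import Data.Bool.Base using (true)
open import Data.Fin.Base using (_↑ʳ_)
open import Data.Integer.Base using (+_; -_)
open import Data.Nat.Base using (_+_; _*_)
open import Data.Product.Base using (_,_)
open import Function.Base using (_∘_; const)
open Family using (MutualNormFamily; mutualNormFamily)
open ShaRank using (NegativeDiscriminant; discriminant; product-squarefree; family-inSel; family-independent)

corollary6p5 : (n : ℕ) → Σ ℤ (λ Δ → IsDisc Δ × ShaRankAtLeast Δ n)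
corollary6p5 n = - + (f * f * m) , isDisc , a ∘ (3 ↑ʳ_) ,
                 family-inSel F disc ∘ (3 ↑ʳ_) , family-independent F disc
  where
  F = mutualNormFamily (3 + n)
  open MutualNormFamily F using (a)
  m = prodSub (3 + n) a (const true)
  disc = discriminant m (product-squarefree F)
  open NegativeDiscriminant disc
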